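{- For each prime $p$, there are infinitely many positive integers that are $p$-practical but not $\lambda$-practical.
   Context: For a prime $p$, a positive integer $n$ is $p$-practical if $x^n-1$ has a divisor in $\mathbb{F}_p[x]$ of every degree $1,\dots,n$; $n$ is $\lambda$-practical if it is $q$-practical for every prime $q$. -}

module Defs where

open import Data.Nat as ℕ using (ℕ; zero; suc; _≤_; _<_)
open import Data.Nat.Primality using (Prime)
open import Data.Integer as ℤ using (ℤ; +_; -[1+_])
open import Data.Integer.Divisibility as ℤD using ()
open import Data.List using (List; []; _∷_; replicate; _++_; map)
open import Data.Product using (Σ; ∃; _×_; _,_)
open import Relation.Nullary using (¬_)

-- Polynomials with integer coefficients, as coefficient lists (constant term first).
-- A polynomial over 𝔽_p is represented by any integer lift; all notions below
-- are taken modulo p, so they are notions about the image in 𝔽_p[x].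
Poly : Set
Poly = List ℤ

coeff : Poly → ℕ → ℤ
coeff []       _       = + 0
coeff (a ∷ f)  zero    = a
coeff (a ∷ f)  (suc k) = coeff f k

_⊕_ : Poly → Poly → Poly
[]      ⊕ g       = g
(a ∷ f) ⊕ []      = a ∷ f
(a ∷ f) ⊕ (b ∷ g) = (a ℤ.+ b) ∷ (f ⊕ g)

_⊛_ : Poly → Poly → Poly
[]      ⊛ g = []
(a ∷ f) ⊛ g = map (a ℤ.*_) g ⊕ (+ 0 ∷ (f ⊛ g))

xⁿ-1 : ℕ → Poly
xⁿ-1 n = (replicate n (+ 0) ++ (+ 1 ∷ [])) ⊕ (-[1+ 0 ] ∷ [])

_≡_[mod_] : ℤ → ℤ → ℕ → Set
a ≡ b [mod p ] = (+ p) ℤD.∣ (a ℤ.- b)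

_≈_[mod_] : Poly → Poly → ℕ → Set
f ≈ g [mod p ] = ∀ k → coeff f k ≡ coeff g k [mod p ]

HasDegree : ℕ → Poly → ℕ → Set
HasDegree p f d = ¬ (coeff f d ≡ + 0 [mod p ]) × (∀ k → d < k → coeff f k ≡ + 0 [mod p ])

Divides : ℕ → Poly → Poly → Set
Divides p f h = ∃ λ (g : Poly) → (f ⊛ g) ≈ h [mod p ]

IsPPractical : ℕ → ℕ → Set
IsPPractical p n = ∀ d → 1 ≤ d → d ≤ n → ∃ λ (f : Poly) → HasDegree p f d × Divides p f (xⁿ-1 n)

IsλPractical : ℕ → Set
IsλPractical n = ∀ q → Prime q → IsPPractical q n

{-# OPTIONS --safe #-}

-- The witnesses are n = p^(N+1) for p ≥ 5, n = 3^(N+2) for p = 3 and n = 14·5^N for p = 2.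
-- For a prime power, x^(p^k) − 1 ≡ (x − 1)^(p^k) (mod p) has the factors (x − 1)^j of every degree.
-- For p = 2, x¹⁴ − 1 is a product of squares of factors of degrees 1, 3, 3, and
-- x^(70m) − 1 ≡ (x^(14m) − 1)·A(x^m) with A a product of squares of factors of degrees 4, 12, 12;
-- such factorisations combine into factors of every degree as long as the new degree steps do not
-- exceed the degree already reached.
-- None of these n is λ-practical: x^n − 1 has no factor of degree 2 over 𝔽₂ (p ≥ 5), of degree 4 over
-- 𝔽₂ (p = 3), or of degree 3 over 𝔽₃ (p = 2). For each monic f of that degree with f(0) ≠ 0, the
-- remainders of x^r modulo f are periodic in r, and x^r ≢ 1 (mod f) for every residue r of n modulo
-- the period; this is checked by computation, while f ∣ x^n − 1 would force x^n ≡ 1 (mod f).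

module Submission where

open import Data.Nat as ℕ using (ℕ; zero; suc; z≤n; s≤s; _∸_; _<_; NonZero)
import Data.Nat.Properties as ℕₚ
import Data.Nat.Divisibility as ℕ∣
open import Data.Nat.DivMod using (m%n<n; m≡m%n+[m/n]*n; %-distribˡ-*)
open import Data.Nat.Combinatorics using (_C_; nCn≡1; nC1≡n; nCk+nC[k+1]≡[n+1]C[k+1]; k>n⇒nCk≡0)
open import Data.Nat.Primality using (Prime; prime?; euclidsLemma; prime⇒irreducible; prime⇒nonZero; prime⇒nonTrivial; prime[2])
open import Data.Nat.Tactic.RingSolver as ℕ-Solver using ()
open import Data.Integer as ℤ using (ℤ; +_; -1ℤ; _+_; _*_; -_; _-_; _^_)
import Data.Integer.Properties as ℤₚ
import Data.Integer.Divisibility as ℤ∣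
open import Data.Integer.Divisibility.Signed using (_∣_; divides; ∣m∣n⇒∣m+n; ∣m⇒∣-m; ∣n⇒∣m*n; ∣⇒∣ᵤ; ∣ᵤ⇒∣; _∣?_)
open import Data.Integer.DivMod using (_%ℕ_; _/ℕ_; a≡a%ℕn+[a/ℕn]*n; n%ℕd<d)
open import Data.Integer.Tactic.RingSolver using (solve-∀)
open import Data.List using (List; []; _∷_; map; replicate; _++_; length; applyUpTo)
import Data.List.Properties as Listₚ
open import Data.List.Membership.Propositional using (_∈_)
open import Data.List.Membership.DecPropositional ℕ._≟_ using (_∈?_)
open import Data.List.Relation.Unary.All as All using (All; []; _∷_; all?)
open import Data.List.Relation.Unary.Any using (here; there)
open import Data.Product using (∃; _×_; _,_; proj₁; proj₂)
open import Data.Sum using (_⊎_; inj₁; inj₂)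
open import Data.Unit using (tt)
open import Data.Empty using (⊥-elim)
open import Relation.Binary using (tri<; tri≈; tri>)
open import Relation.Binary.PropositionalEquality
open import Relation.Nullary using (¬_; Dec; yes; no; ¬?)
open import Relation.Nullary.Decidable using (True; toWitness; _⊎-dec_; _×-dec_)
open import Defs


Series : Set
Series = ℕ → ℤ

variable
  p d e : ℕ
  F F′ G G′ H : Series
  P Q : Poly

infixl 6 _+ˢ_
infixr 7 _•ˢ_
infixl 7 _*ˢ_

_+ˢ_ : Series → Series → Series
(F +ˢ G) k = F k + G k

_•ˢ_ : ℤ → Series → Series
(c •ˢ F) k = c * F k

0ˢ : Series
0ˢ _ = + 0

1ˢ : Series
1ˢ zero    = + 1
1ˢ (suc _) = + 0

shift : Series → Series
shift F zero    = + 0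
shift F (suc k) = F k

tail : Series → Series
tail F k = F (suc k)

_*ˢ_ : Series → Series → Series
(F *ˢ G) zero    = F 0 * G 0
(F *ˢ G) (suc k) = F 0 * G (suc k) + (tail F *ˢ G) k

shift-cong : F ≗ G → shift F ≗ shift G
shift-cong e zero    = refl
shift-cong e (suc k) = e k

shift-+ˢ : ∀ F G → shift (F +ˢ G) ≗ shift F +ˢ shift G
shift-+ˢ F G zero    = refl
shift-+ˢ F G (suc k) = refl

*ˢ-cong : F ≗ F′ → G ≗ G′ → F *ˢ G ≗ F′ *ˢ G′
*ˢ-cong eF eG zero    = cong₂ _*_ (eF 0) (eG 0)
*ˢ-cong eF eG (suc k) =
  cong₂ _+_ (cong₂ _*_ (eF 0) (eG (suc k))) (*ˢ-cong (λ j → eF (suc j)) eG k)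

*ˢ-congˡ : F ≗ F′ → F *ˢ G ≗ F′ *ˢ G
*ˢ-congˡ eF = *ˢ-cong eF (λ _ → refl)

*ˢ-congʳ : G ≗ G′ → F *ˢ G ≗ F *ˢ G′
*ˢ-congʳ = *ˢ-cong (λ _ → refl)

*ˢ-zeroˡ : ∀ G → 0ˢ *ˢ G ≗ 0ˢ
*ˢ-zeroˡ G zero    = ℤₚ.*-zeroˡ (G 0)
*ˢ-zeroˡ G (suc k) = cong₂ _+_ (ℤₚ.*-zeroˡ (G (suc k))) (*ˢ-zeroˡ G k)

*ˢ-identityˡ : ∀ G → 1ˢ *ˢ G ≗ G
*ˢ-identityˡ G zero    = ℤₚ.*-identityˡ (G 0)
*ˢ-identityˡ G (suc k) = begin
  + 1 * G (suc k) + (0ˢ *ˢ G) k ≡⟨ cong₂ _+_ (ℤₚ.*-identityˡ (G (suc k))) (*ˢ-zeroˡ G k) ⟩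
  G (suc k) + + 0               ≡⟨ ℤₚ.+-identityʳ _ ⟩
  G (suc k)                     ∎
  where open ≡-Reasoning

shift-*ˢ : ∀ F G → shift F *ˢ G ≗ shift (F *ˢ G)
shift-*ˢ F G zero    = ℤₚ.*-zeroˡ (G 0)
shift-*ˢ F G (suc k) =
  trans (cong (_+ (F *ˢ G) k) (ℤₚ.*-zeroˡ (G (suc k)))) (ℤₚ.+-identityˡ _)

*ˢ-distribʳ-+ˢ : ∀ F F′ G → (F +ˢ F′) *ˢ G ≗ F *ˢ G +ˢ F′ *ˢ G
*ˢ-distribʳ-+ˢ F F′ G zero    = ℤₚ.*-distribʳ-+ (G 0) (F 0) (F′ 0)
*ˢ-distribʳ-+ˢ F F′ G (suc k) = begin
  (F 0 + F′ 0) * G (suc k) + ((tail F +ˢ tail F′) *ˢ G) k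
    ≡⟨ cong (_+_ ((F 0 + F′ 0) * G (suc k))) (*ˢ-distribʳ-+ˢ (tail F) (tail F′) G k) ⟩
  (F 0 + F′ 0) * G (suc k) + ((tail F *ˢ G) k + (tail F′ *ˢ G) k)
    ≡⟨ regroup (F 0) (F′ 0) (G (suc k)) _ _ ⟩
  (F 0 * G (suc k) + (tail F *ˢ G) k) + (F′ 0 * G (suc k) + (tail F′ *ˢ G) k) ∎
  where
  open ≡-Reasoning
  regroup : ∀ a b c d e → (a + b) * c + (d + e) ≡ (a * c + d) + (b * c + e)
  regroup = solve-∀

•ˢ-*ˢ-assoc : ∀ c F G → (c •ˢ F) *ˢ G ≗ c •ˢ (F *ˢ G)
•ˢ-*ˢ-assoc c F G zero    = ℤₚ.*-assoc c (F 0) (G 0)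
•ˢ-*ˢ-assoc c F G (suc k) =
  trans (cong (_+_ (c * F 0 * G (suc k))) (•ˢ-*ˢ-assoc c (tail F) G k))
        (factor c (F 0) (G (suc k)) _)
  where
  factor : ∀ a b d e → a * b * d + a * e ≡ a * (b * d + e)
  factor = solve-∀

*ˢ-unfoldʳ : ∀ F G k → (F *ˢ G) (suc k) ≡ (F *ˢ tail G) k + F (suc k) * G 0
*ˢ-unfoldʳ F G zero    = refl
*ˢ-unfoldʳ F G (suc k) =
  trans (cong (_+_ (F 0 * G (suc (suc k)))) (*ˢ-unfoldʳ (tail F) G k))
        (sym (ℤₚ.+-assoc (F 0 * G (suc (suc k))) _ _))

*ˢ-comm : ∀ F G → F *ˢ G ≗ G *ˢ F
*ˢ-comm F G zero    = ℤₚ.*-comm (F 0) (G 0)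
*ˢ-comm F G (suc k) = begin
  F 0 * G (suc k) + (tail F *ˢ G) k ≡⟨ cong (_+_ (F 0 * G (suc k))) (*ˢ-comm (tail F) G k) ⟩
  F 0 * G (suc k) + (G *ˢ tail F) k ≡⟨ swap (F 0) (G (suc k)) _ ⟩
  (G *ˢ tail F) k + G (suc k) * F 0 ≡⟨ *ˢ-unfoldʳ G F k ⟨
  (G *ˢ F) (suc k)                  ∎
  where
  open ≡-Reasoning
  swap : ∀ a b c → a * b + c ≡ c + b * a
  swap = solve-∀

*ˢ-distribˡ-+ˢ : ∀ F G G′ → F *ˢ (G +ˢ G′) ≗ F *ˢ G +ˢ F *ˢ G′
*ˢ-distribˡ-+ˢ F G G′ k = begin
  (F *ˢ (G +ˢ G′)) k           ≡⟨ *ˢ-comm F (G +ˢ G′) k ⟩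
  ((G +ˢ G′) *ˢ F) k           ≡⟨ *ˢ-distribʳ-+ˢ G G′ F k ⟩
  (G *ˢ F) k + (G′ *ˢ F) k     ≡⟨ cong₂ _+_ (*ˢ-comm G F k) (*ˢ-comm G′ F k) ⟩
  (F *ˢ G) k + (F *ˢ G′) k     ∎
  where open ≡-Reasoning

*ˢ-•ˢ-comm : ∀ c F G → F *ˢ (c •ˢ G) ≗ c •ˢ (F *ˢ G)
*ˢ-•ˢ-comm c F G k =
  trans (*ˢ-comm F (c •ˢ G) k) (trans (•ˢ-*ˢ-assoc c G F k) (cong (c *_) (*ˢ-comm G F k)))

*ˢ-shift : ∀ F G → F *ˢ shift G ≗ shift (F *ˢ G)
*ˢ-shift F G k =
  trans (*ˢ-comm F (shift G) k) (trans (shift-*ˢ G F k) (shift-cong (*ˢ-comm G F) k))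

*ˢ-identityʳ : ∀ F → F *ˢ 1ˢ ≗ F
*ˢ-identityʳ F k = trans (*ˢ-comm F 1ˢ k) (*ˢ-identityˡ F k)

*ˢ-assoc : ∀ F G H → (F *ˢ G) *ˢ H ≗ F *ˢ (G *ˢ H)
*ˢ-assoc F G H zero    = ℤₚ.*-assoc (F 0) (G 0) (H 0)
*ˢ-assoc F G H (suc k) = begin
  F 0 * G 0 * H (suc k) + ((F 0 •ˢ tail G +ˢ tail F *ˢ G) *ˢ H) k
    ≡⟨ cong (_+_ (F 0 * G 0 * H (suc k))) (*ˢ-distribʳ-+ˢ (F 0 •ˢ tail G) (tail F *ˢ G) H k) ⟩
  F 0 * G 0 * H (suc k) + (((F 0 •ˢ tail G) *ˢ H) k + ((tail F *ˢ G) *ˢ H) k)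
    ≡⟨ cong₂ (λ a b → F 0 * G 0 * H (suc k) + (a + b))
             (•ˢ-*ˢ-assoc (F 0) (tail G) H k) (*ˢ-assoc (tail F) G H k) ⟩
  F 0 * G 0 * H (suc k) + (F 0 * (tail G *ˢ H) k + (tail F *ˢ (G *ˢ H)) k)
    ≡⟨ factor (F 0) (G 0) (H (suc k)) _ _ ⟩
  F 0 * (G 0 * H (suc k) + (tail G *ˢ H) k) + (tail F *ˢ (G *ˢ H)) k
    ∎
  where
  open ≡-Reasoning
  factor : ∀ a b c d e → a * b * c + (a * d + e) ≡ a * (b * c + d) + e
  factor = solve-∀

*ˢ-interchange : ∀ F G F′ G′ → (F *ˢ G) *ˢ (F′ *ˢ G′) ≗ (F *ˢ F′) *ˢ (G *ˢ G′)
*ˢ-interchange F G F′ G′ k = begin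
  ((F *ˢ G) *ˢ (F′ *ˢ G′)) k   ≡⟨ *ˢ-assoc F G (F′ *ˢ G′) k ⟩
  (F *ˢ (G *ˢ (F′ *ˢ G′))) k   ≡⟨ *ˢ-congʳ (λ j → sym (*ˢ-assoc G F′ G′ j)) k ⟩
  (F *ˢ ((G *ˢ F′) *ˢ G′)) k   ≡⟨ *ˢ-congʳ (*ˢ-congˡ (*ˢ-comm G F′)) k ⟩
  (F *ˢ ((F′ *ˢ G) *ˢ G′)) k   ≡⟨ *ˢ-congʳ (*ˢ-assoc F′ G G′) k ⟩
  (F *ˢ (F′ *ˢ (G *ˢ G′))) k   ≡⟨ *ˢ-assoc F F′ (G *ˢ G′) k ⟨
  ((F *ˢ F′) *ˢ (G *ˢ G′)) k   ∎
  where open ≡-Reasoning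

∣0 : + p ∣ + 0
∣0 {p} = divides (+ 0) (sym (ℤₚ.*-zeroˡ (+ p)))

≡0⇒∣ : ∀ {x} → x ≡ + 0 → + p ∣ x
≡0⇒∣ eq = subst (_ ∣_) (sym eq) ∣0

∣-self-diff : ∀ a → + p ∣ a - a
∣-self-diff a = subst (_ ∣_) (sym (ℤₚ.+-inverseʳ a)) ∣0

infix 4 _≈ˢ_[mod_]
record _≈ˢ_[mod_] (F G : Series) (p : ℕ) : Set where
  constructor mk≈ˢ
  field coeff-∣ : ∀ k → + p ∣ F k - G k
open _≈ˢ_[mod_]

≗⇒≈ˢ : F ≗ G → F ≈ˢ G [mod p ]
≗⇒≈ˢ {F} e = mk≈ˢ λ k → subst (_ ∣_) (cong (_-_ (F k)) (e k)) (∣-self-diff (F k))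

≈ˢ-refl : F ≈ˢ F [mod p ]
≈ˢ-refl = ≗⇒≈ˢ (λ _ → refl)

≈ˢ-sym : F ≈ˢ G [mod p ] → G ≈ˢ F [mod p ]
≈ˢ-sym {F} {G} e = mk≈ˢ λ k → subst (_ ∣_) (negate (F k) (G k)) (∣m⇒∣-m (coeff-∣ e k))
  where
  negate : ∀ a b → - (a - b) ≡ b - a
  negate = solve-∀

≈ˢ-trans : F ≈ˢ G [mod p ] → G ≈ˢ H [mod p ] → F ≈ˢ H [mod p ]
≈ˢ-trans {F = F} {G = G} {H = H} e e′ =
  mk≈ˢ λ k → subst (_ ∣_) (telescope (F k) (G k) (H k)) (∣m∣n⇒∣m+n (coeff-∣ e k) (coeff-∣ e′ k))
  where
  telescope : ∀ a b c → (a - b) + (b - c) ≡ a - c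
  telescope = solve-∀

shift-≈ˢ : F ≈ˢ G [mod p ] → shift F ≈ˢ shift G [mod p ]
shift-≈ˢ e = mk≈ˢ λ { zero → ∣0 ; (suc k) → coeff-∣ e k }

*ˢ-≈ˢˡ : ∀ G → F ≈ˢ F′ [mod p ] → F *ˢ G ≈ˢ F′ *ˢ G [mod p ]
*ˢ-≈ˢˡ G e = mk≈ˢ (coefficient _ _ (coeff-∣ e))
  where
  coefficient : ∀ F F′ → (∀ k → + p ∣ F k - F′ k) → ∀ k → + p ∣ (F *ˢ G) k - (F′ *ˢ G) k
  coefficient F F′ e zero = subst (_ ∣_) (expand (F 0) (F′ 0) (G 0)) (∣n⇒∣m*n (G 0) (e 0))
    where
    expand : ∀ a b c → c * (a - b) ≡ a * c - b * c
    expand = solve-∀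
  coefficient F F′ e (suc k) =
    subst (_ ∣_) (expand (F 0) (F′ 0) (G (suc k)) _ _)
      (∣m∣n⇒∣m+n (∣n⇒∣m*n (G (suc k)) (e 0)) (coefficient (tail F) (tail F′) (λ j → e (suc j)) k))
    where
    expand : ∀ a b c x y → c * (a - b) + (x - y) ≡ (a * c + x) - (b * c + y)
    expand = solve-∀

*ˢ-≈ˢ : F ≈ˢ F′ [mod p ] → G ≈ˢ G′ [mod p ] → F *ˢ G ≈ˢ F′ *ˢ G′ [mod p ]
*ˢ-≈ˢ {F = F} {F′ = F′} {G = G} {G′ = G′} eF eG =
  ≈ˢ-trans (*ˢ-≈ˢˡ G eF) (≈ˢ-trans (≗⇒≈ˢ (*ˢ-comm F′ G))
    (≈ˢ-trans (*ˢ-≈ˢˡ F′ eG) (≗⇒≈ˢ (*ˢ-comm G′ F′))))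

coeff-⊕ : ∀ f g → coeff (f ⊕ g) ≗ coeff f +ˢ coeff g
coeff-⊕ []      g       k       = sym (ℤₚ.+-identityˡ _)
coeff-⊕ (a ∷ f) []      k       = sym (ℤₚ.+-identityʳ _)
coeff-⊕ (a ∷ f) (b ∷ g) zero    = refl
coeff-⊕ (a ∷ f) (b ∷ g) (suc k) = coeff-⊕ f g k

coeff-map-* : ∀ a g → coeff (map (a *_) g) ≗ a •ˢ coeff g
coeff-map-* a []      k       = sym (ℤₚ.*-zeroʳ a)
coeff-map-* a (b ∷ g) zero    = refl
coeff-map-* a (b ∷ g) (suc k) = coeff-map-* a g k

coeff-⊛ : ∀ f g → coeff (f ⊛ g) ≗ coeff f *ˢ coeff g
coeff-⊛ []      g k       = sym (*ˢ-zeroˡ (coeff g) k)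
coeff-⊛ (a ∷ f) g zero    =
  trans (coeff-⊕ (map (a *_) g) (+ 0 ∷ (f ⊛ g)) 0)
        (trans (cong (_+ + 0) (coeff-map-* a g 0)) (ℤₚ.+-identityʳ _))
coeff-⊛ (a ∷ f) g (suc k) =
  trans (coeff-⊕ (map (a *_) g) (+ 0 ∷ (f ⊛ g)) (suc k))
        (cong₂ _+_ (coeff-map-* a g (suc k)) (coeff-⊛ f g k))

coeff-∷ : ∀ a f → coeff (a ∷ f) ≗ a •ˢ 1ˢ +ˢ shift (coeff f)
coeff-∷ a f zero    = sym (trans (cong (_+ + 0) (ℤₚ.*-identityʳ a)) (ℤₚ.+-identityʳ a))
coeff-∷ a f (suc k) = sym (trans (cong (_+ coeff f k) (ℤₚ.*-zeroʳ a)) (ℤₚ.+-identityˡ _))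

monomial : ℕ → Series
monomial zero    = 1ˢ
monomial (suc n) = shift (monomial n)

-1ˢ : Series
-1ˢ zero    = -1ℤ
-1ˢ (suc _) = + 0

coeff-xⁿ-1 : ∀ n → coeff (xⁿ-1 n) ≗ monomial n +ˢ -1ˢ
coeff-xⁿ-1 n k =
  trans (coeff-⊕ (replicate n (+ 0) ++ (+ 1 ∷ [])) (-1ℤ ∷ []) k)
        (cong₂ _+_ (coeff-xⁿ n k) (-1-coeff k))
  where
  -1-coeff : ∀ k → coeff (-1ℤ ∷ []) k ≡ -1ˢ k
  -1-coeff zero    = refl
  -1-coeff (suc k) = refl
  coeff-xⁿ : ∀ n k → coeff (replicate n (+ 0) ++ (+ 1 ∷ [])) k ≡ monomial n k
  coeff-xⁿ zero    zero    = refl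
  coeff-xⁿ zero    (suc k) = refl
  coeff-xⁿ (suc n) zero    = refl
  coeff-xⁿ (suc n) (suc k) = coeff-xⁿ n k

shiftBy : ℕ → Series → Series
shiftBy zero    F = F
shiftBy (suc j) F = shift (shiftBy j F)

shiftBy-cong : ∀ j → F ≗ G → shiftBy j F ≗ shiftBy j G
shiftBy-cong zero    e = e
shiftBy-cong (suc j) e = shift-cong (shiftBy-cong j e)

shiftBy-≥ : ∀ j F k → j ℕ.≤ k → shiftBy j F k ≡ F (k ∸ j)
shiftBy-≥ zero    F k       _         = refl
shiftBy-≥ (suc j) F (suc k) (s≤s j≤k) = shiftBy-≥ j F k j≤k

shiftBy-*ˢ : ∀ j F G → shiftBy j F *ˢ G ≗ shiftBy j (F *ˢ G)
shiftBy-*ˢ zero    F G k = refl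
shiftBy-*ˢ (suc j) F G k = trans (shift-*ˢ (shiftBy j F) G k) (shift-cong (shiftBy-*ˢ j F G) k)

monomial-+ : ∀ a b → monomial (a ℕ.+ b) ≗ shiftBy a (monomial b)
monomial-+ zero    b k = refl
monomial-+ (suc a) b   = shift-cong (monomial-+ a b)

-- stretchAfter m j F = x^j · F(x^(1+m)): after j zeros, the coefficients of F with m zeros between them.
stretchAfter : ℕ → ℕ → Series → Series
stretchAfter m zero    F zero    = F 0
stretchAfter m zero    F (suc k) = stretchAfter m m (tail F) k
stretchAfter m (suc j) F zero    = + 0
stretchAfter m (suc j) F (suc k) = stretchAfter m j F k

stretch : ℕ → Series → Series
stretch m = stretchAfter m 0

stretchAfter-cong : ∀ m j → F ≗ G → stretchAfter m j F ≗ stretchAfter m j G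
stretchAfter-cong m zero    e zero    = e 0
stretchAfter-cong m zero    e (suc k) = stretchAfter-cong m m (λ i → e (suc i)) k
stretchAfter-cong m (suc j) e zero    = refl
stretchAfter-cong m (suc j) e (suc k) = stretchAfter-cong m j e k

stretchAfter-zip : ∀ (op : ℤ → ℤ → ℤ) → op (+ 0) (+ 0) ≡ + 0 → ∀ m j F G →
  stretchAfter m j (λ i → op (F i) (G i)) ≗ λ k → op (stretchAfter m j F k) (stretchAfter m j G k)
stretchAfter-zip op z m zero    F G zero    = refl
stretchAfter-zip op z m zero    F G (suc k) = stretchAfter-zip op z m m (tail F) (tail G) k
stretchAfter-zip op z m (suc j) F G zero    = sym z
stretchAfter-zip op z m (suc j) F G (suc k) = stretchAfter-zip op z m j F G k

stretchAfter-all : ∀ (P : ℤ → Set) → P (+ 0) → ∀ m j F → (∀ i → P (F i)) →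
  ∀ k → P (stretchAfter m j F k)
stretchAfter-all P z m zero    F all zero    = all 0
stretchAfter-all P z m zero    F all (suc k) = stretchAfter-all P z m m (tail F) (λ i → all (suc i)) k
stretchAfter-all P z m (suc j) F all zero    = z
stretchAfter-all P z m (suc j) F all (suc k) = stretchAfter-all P z m j F all k

stretchAfter≗shiftBy : ∀ m j F → stretchAfter m j F ≗ shiftBy j (stretch m F)
stretchAfter≗shiftBy m zero    F k       = refl
stretchAfter≗shiftBy m (suc j) F zero    = refl
stretchAfter≗shiftBy m (suc j) F (suc k) = stretchAfter≗shiftBy m j F k

stretch-+ˢ : ∀ m F G → stretch m (F +ˢ G) ≗ stretch m F +ˢ stretch m G
stretch-+ˢ m = stretchAfter-zip _+_ refl m 0

stretch-•ˢ : ∀ m c F → stretch m (c •ˢ F) ≗ c •ˢ stretch m F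
stretch-•ˢ m c F = stretchAfter-zip (λ a _ → c * a) (ℤₚ.*-zeroʳ c) m 0 F F

stretch-0ˢ : ∀ m → stretch m 0ˢ ≗ 0ˢ
stretch-0ˢ m = stretchAfter-all (_≡ + 0) refl m 0 0ˢ (λ _ → refl)

stretch-1ˢ : ∀ m → stretch m 1ˢ ≗ 1ˢ
stretch-1ˢ m zero    = refl
stretch-1ˢ m (suc k) = stretchAfter-all (_≡ + 0) refl m m 0ˢ (λ _ → refl) k

stretch--1ˢ : ∀ m → stretch m -1ˢ ≗ -1ˢ
stretch--1ˢ m zero    = refl
stretch--1ˢ m (suc k) = stretchAfter-all (_≡ + 0) refl m m 0ˢ (λ _ → refl) k

stretch-shift : ∀ m F → stretch m (shift F) ≗ shiftBy (suc m) (stretch m F)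
stretch-shift m F zero    = refl
stretch-shift m F (suc k) = stretchAfter≗shiftBy m m F k

stretch-≈ˢ : ∀ m → F ≈ˢ G [mod p ] → stretch m F ≈ˢ stretch m G [mod p ]
stretch-≈ˢ {F = F} {G = G} m e = mk≈ˢ λ k →
  subst (_ ∣_) (stretchAfter-zip _-_ refl m 0 F G k)
    (stretchAfter-all (_ ∣_) ∣0 m 0 (λ i → F i - G i) (coeff-∣ e) k)

stretch-monomial : ∀ m n → stretch m (monomial n) ≗ monomial (n ℕ.* suc m)
stretch-monomial m zero    = stretch-1ˢ m
stretch-monomial m (suc n) k = begin
  stretch m (shift (monomial n)) k          ≡⟨ stretch-shift m (monomial n) k ⟩
  shiftBy (suc m) (stretch m (monomial n)) k ≡⟨ shiftBy-cong (suc m) (stretch-monomial m n) k ⟩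
  shiftBy (suc m) (monomial (n ℕ.* suc m)) k ≡⟨ monomial-+ (suc m) (n ℕ.* suc m) k ⟨
  monomial (suc m ℕ.+ n ℕ.* suc m) k         ∎
  where open ≡-Reasoning

stretch-*ˢ : ∀ m f G → stretch m (coeff f *ˢ G) ≗ stretch m (coeff f) *ˢ stretch m G
stretch-*ˢ m [] G k = begin
  stretch m (coeff [] *ˢ G) k  ≡⟨ stretchAfter-cong m 0 (*ˢ-zeroˡ G) k ⟩
  stretch m 0ˢ k               ≡⟨ stretch-0ˢ m k ⟩
  + 0                          ≡⟨ *ˢ-zeroˡ (stretch m G) k ⟨
  (0ˢ *ˢ stretch m G) k        ≡⟨ *ˢ-congˡ (stretch-0ˢ m) k ⟨
  (stretch m 0ˢ *ˢ stretch m G) k ∎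
  where open ≡-Reasoning
stretch-*ˢ m (a ∷ f) G k = begin
  stretch m (coeff (a ∷ f) *ˢ G) k
    ≡⟨ stretchAfter-cong m 0 (λ i → trans (*ˢ-congˡ (coeff-∷ a f) i) (expand (coeff f) G i)) k ⟩
  stretch m (a •ˢ G +ˢ shift (coeff f *ˢ G)) k
    ≡⟨ stretch-+ˢ m (a •ˢ G) (shift (coeff f *ˢ G)) k ⟩
  stretch m (a •ˢ G) k + stretch m (shift (coeff f *ˢ G)) k
    ≡⟨ cong₂ _+_ (stretch-•ˢ m a G k) (stretch-shift m (coeff f *ˢ G) k) ⟩
  a * SG k + shiftBy (suc m) (stretch m (coeff f *ˢ G)) k
    ≡⟨ cong (_+_ (a * SG k)) (shiftBy-cong (suc m) (stretch-*ˢ m f G) k) ⟩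
  a * SG k + shiftBy (suc m) (SF *ˢ SG) k
    ≡⟨ expand′ k ⟨
  ((stretch m (a •ˢ 1ˢ) +ˢ shiftBy (suc m) SF) *ˢ SG) k
    ≡⟨ *ˢ-congˡ (λ i → trans (stretch-+ˢ m (a •ˢ 1ˢ) (shift (coeff f)) i)
                             (cong (_+_ (stretch m (a •ˢ 1ˢ) i)) (stretch-shift m (coeff f) i))) k ⟨
  (stretch m (a •ˢ 1ˢ +ˢ shift (coeff f)) *ˢ SG) k
    ≡⟨ *ˢ-congˡ (stretchAfter-cong m 0 (coeff-∷ a f)) k ⟨
  (stretch m (coeff (a ∷ f)) *ˢ SG) k ∎
  where
  open ≡-Reasoning
  SF = stretch m (coeff f)
  SG = stretch m G
  scale-unit : ∀ c H → (c •ˢ 1ˢ) *ˢ H ≗ c •ˢ H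
  scale-unit c H i = trans (•ˢ-*ˢ-assoc c 1ˢ H i) (cong (c *_) (*ˢ-identityˡ H i))
  expand : ∀ F G → (a •ˢ 1ˢ +ˢ shift F) *ˢ G ≗ a •ˢ G +ˢ shift (F *ˢ G)
  expand F G i = trans (*ˢ-distribʳ-+ˢ (a •ˢ 1ˢ) (shift F) G i)
                       (cong₂ _+_ (scale-unit a G i) (shift-*ˢ F G i))
  expand′ : (stretch m (a •ˢ 1ˢ) +ˢ shiftBy (suc m) SF) *ˢ SG ≗ a •ˢ SG +ˢ shiftBy (suc m) (SF *ˢ SG)
  expand′ i = trans (*ˢ-distribʳ-+ˢ (stretch m (a •ˢ 1ˢ)) (shiftBy (suc m) SF) SG i)
    (cong₂ _+_ (trans (*ˢ-congˡ (λ l → trans (stretch-•ˢ m a 1ˢ l) (cong (a *_) (stretch-1ˢ m l))) i)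
                      (scale-unit a SG i))
               (shiftBy-*ˢ (suc m) SF SG i))

inflate : ℕ → Poly → Poly
inflate m []      = []
inflate m (a ∷ f) = a ∷ (replicate m (+ 0) ++ inflate m f)

coeff-inflate : ∀ m f → coeff (inflate m f) ≗ stretch m (coeff f)
coeff-inflate m []      k       = sym (stretch-0ˢ m k)
coeff-inflate m (a ∷ f) zero    = refl
coeff-inflate m (a ∷ f) (suc k) = padded m k
  where
  padded : ∀ j k → coeff (replicate j (+ 0) ++ inflate m f) k ≡ stretchAfter m j (coeff f) k
  padded zero    k       = coeff-inflate m f k
  padded (suc j) zero    = refl
  padded (suc j) (suc k) = padded j k

inflate-⊛ : ∀ m f g → coeff (inflate m (f ⊛ g)) ≗ coeff (inflate m f) *ˢ coeff (inflate m g)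
inflate-⊛ m f g k = begin
  coeff (inflate m (f ⊛ g)) k                          ≡⟨ coeff-inflate m (f ⊛ g) k ⟩
  stretch m (coeff (f ⊛ g)) k                          ≡⟨ stretchAfter-cong m 0 (coeff-⊛ f g) k ⟩
  stretch m (coeff f *ˢ coeff g) k                     ≡⟨ stretch-*ˢ m f (coeff g) k ⟩
  (stretch m (coeff f) *ˢ stretch m (coeff g)) k       ≡⟨ *ˢ-cong (coeff-inflate m f) (coeff-inflate m g) k ⟨
  (coeff (inflate m f) *ˢ coeff (inflate m g)) k       ∎
  where open ≡-Reasoning

inflate-xⁿ-1 : ∀ m n → coeff (inflate m (xⁿ-1 n)) ≗ coeff (xⁿ-1 (n ℕ.* suc m))
inflate-xⁿ-1 m n k = begin
  coeff (inflate m (xⁿ-1 n)) k                     ≡⟨ coeff-inflate m (xⁿ-1 n) k ⟩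
  stretch m (coeff (xⁿ-1 n)) k                     ≡⟨ stretchAfter-cong m 0 (coeff-xⁿ-1 n) k ⟩
  stretch m (monomial n +ˢ -1ˢ) k                  ≡⟨ stretch-+ˢ m (monomial n) -1ˢ k ⟩
  stretch m (monomial n) k + stretch m -1ˢ k       ≡⟨ cong₂ _+_ (stretch-monomial m n k) (stretch--1ˢ m k) ⟩
  monomial (n ℕ.* suc m) k + -1ˢ k                 ≡⟨ coeff-xⁿ-1 (n ℕ.* suc m) k ⟨
  coeff (xⁿ-1 (n ℕ.* suc m)) k                     ∎
  where open ≡-Reasoning

inflate-≈ˢ : ∀ m f g → coeff f ≈ˢ coeff g [mod p ] → coeff (inflate m f) ≈ˢ coeff (inflate m g) [mod p ]
inflate-≈ˢ m f g e =
  ≈ˢ-trans (≗⇒≈ˢ (coeff-inflate m f))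
    (≈ˢ-trans (stretch-≈ˢ m e) (≈ˢ-sym (≗⇒≈ˢ (coeff-inflate m g))))

Monicˢ : ℕ → Series → Set
Monicˢ d F = F d ≡ + 1 × (∀ k → d < k → F k ≡ + 0)

Monicˢ-cong : F ≗ G → Monicˢ d F → Monicˢ d G
Monicˢ-cong eq (top , above) = trans (sym (eq _)) top , λ k d<k → trans (sym (eq k)) (above k d<k)

Monicˢ-tail : Monicˢ (suc d) F → Monicˢ d (tail F)
Monicˢ-tail (top , above) = top , λ k d<k → above (suc k) (s≤s d<k)

Monicˢ-zero : Monicˢ 0 F → F ≗ 1ˢ
Monicˢ-zero (top , above) zero    = top
Monicˢ-zero (top , above) (suc k) = above (suc k) (s≤s z≤n)

Monicˢ-*ˢ : ∀ d e F G → Monicˢ d F → Monicˢ e G → Monicˢ (d ℕ.+ e) (F *ˢ G)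
Monicˢ-*ˢ zero e F G monF monG =
  Monicˢ-cong (λ k → sym (trans (*ˢ-congˡ (Monicˢ-zero monF) k) (*ˢ-identityˡ G k))) monG
Monicˢ-*ˢ (suc d) e F G monF monG@(_ , Gabove) = top , above
  where
  IH = Monicˢ-*ˢ d e (tail F) G (Monicˢ-tail monF) monG
  lead-vanishes : ∀ k → d ℕ.+ e ℕ.≤ k → F 0 * G (suc k) ≡ + 0
  lead-vanishes k le =
    trans (cong (F 0 *_) (Gabove (suc k) (s≤s (ℕₚ.≤-trans (ℕₚ.m≤n+m e d) le)))) (ℤₚ.*-zeroʳ (F 0))
  top : (F *ˢ G) (suc (d ℕ.+ e)) ≡ + 1
  top = trans (cong₂ _+_ (lead-vanishes _ ℕₚ.≤-refl) (proj₁ IH)) (ℤₚ.+-identityˡ _)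
  above : ∀ k → suc (d ℕ.+ e) < k → (F *ˢ G) k ≡ + 0
  above (suc k) (s≤s lt) = trans (cong₂ _+_ (lead-vanishes k (ℕₚ.<⇒≤ lt)) (proj₂ IH k lt)) (ℤₚ.+-identityˡ _)

Monicˢ-stretch : ∀ d m F → Monicˢ d F → Monicˢ (d ℕ.* suc m) (stretch m F)
Monicˢ-stretch zero m F monF =
  Monicˢ-cong (λ k → sym (trans (stretchAfter-cong m 0 (Monicˢ-zero monF) k) (stretch-1ˢ m k)))
              (refl , λ { (suc k) _ → refl })
Monicˢ-stretch (suc d) m F monF = top , above
  where
  IH = Monicˢ-stretch d m (tail F) (Monicˢ-tail monF)
  D = d ℕ.* suc m
  m≤m+D = ℕₚ.m≤m+n m D
  top : stretchAfter m m (tail F) (m ℕ.+ D) ≡ + 1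
  top = begin
    stretchAfter m m (tail F) (m ℕ.+ D)       ≡⟨ stretchAfter≗shiftBy m m (tail F) (m ℕ.+ D) ⟩
    shiftBy m (stretch m (tail F)) (m ℕ.+ D)  ≡⟨ shiftBy-≥ m _ (m ℕ.+ D) m≤m+D ⟩
    stretch m (tail F) (m ℕ.+ D ∸ m)          ≡⟨ cong (stretch m (tail F)) (ℕₚ.m+n∸m≡n m D) ⟩
    stretch m (tail F) D                      ≡⟨ proj₁ IH ⟩
    + 1                                       ∎
    where open ≡-Reasoning
  above : ∀ k → suc (m ℕ.+ D) < k → stretch m F k ≡ + 0
  above (suc k) (s≤s lt) = begin
    stretchAfter m m (tail F) k         ≡⟨ stretchAfter≗shiftBy m m (tail F) k ⟩
    shiftBy m (stretch m (tail F)) k    ≡⟨ shiftBy-≥ m _ k m≤k ⟩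
    stretch m (tail F) (k ∸ m)          ≡⟨ proj₂ IH (k ∸ m) D<k∸m ⟩
    + 0                                 ∎
    where
    open ≡-Reasoning
    m≤k = ℕₚ.≤-trans m≤m+D (ℕₚ.<⇒≤ lt)
    D<k∸m : D < k ∸ m
    D<k∸m = ℕₚ.+-cancelˡ-< m D (k ∸ m) (subst (m ℕ.+ D <_) (sym (ℕₚ.m+[n∸m]≡n m≤k)) lt)

monicOf : List ℤ → Poly
monicOf v = v ++ (+ 1 ∷ [])

monicOf-monic : ∀ v → Monicˢ (length v) (coeff (monicOf v))
monicOf-monic []      = refl , λ { (suc k) _ → refl }
monicOf-monic (a ∷ v) = proj₁ (monicOf-monic v) , λ { (suc k) (s≤s lt) → proj₂ (monicOf-monic v) k lt }

record MonicFactor (p : ℕ) (P : Poly) (d : ℕ) : Set where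
  constructor monicFactor
  field
    factor     : Poly
    cofactor   : Poly
    monic      : Monicˢ d (coeff factor)
    factorises : coeff factor *ˢ coeff cofactor ≈ˢ coeff P [mod p ]

MonicFactor-≈ˢ : coeff P ≈ˢ coeff Q [mod p ] → MonicFactor p P d → MonicFactor p Q d
MonicFactor-≈ˢ P≈Q (monicFactor f g monic fg≈P) = monicFactor f g monic (≈ˢ-trans fg≈P P≈Q)

1ᴾ : Poly
1ᴾ = + 1 ∷ []

coeff-1ᴾ : coeff 1ᴾ ≗ 1ˢ
coeff-1ᴾ zero    = refl
coeff-1ᴾ (suc k) = refl

MonicFactor-one : ∀ p P → MonicFactor p P 0
MonicFactor-one p P = monicFactor 1ᴾ P (refl , λ { (suc k) _ → refl })
  (≗⇒≈ˢ λ k → trans (*ˢ-congˡ coeff-1ᴾ k) (*ˢ-identityˡ (coeff P) k))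

MonicFactor-self : ∀ p P → Monicˢ d (coeff P) → MonicFactor p P d
MonicFactor-self p P monic = monicFactor P 1ᴾ monic
  (≗⇒≈ˢ λ k → trans (*ˢ-congʳ coeff-1ᴾ k) (*ˢ-identityʳ (coeff P) k))

MonicFactor-⊛ : MonicFactor p P d → MonicFactor p Q e → MonicFactor p (P ⊛ Q) (d ℕ.+ e)
MonicFactor-⊛ {P = P} {d = d} {Q = Q} {e = e} (monicFactor f g monf fg≈P) (monicFactor f′ g′ monf′ fg≈Q) =
  monicFactor (f ⊛ f′) (g ⊛ g′)
    (Monicˢ-cong (λ k → sym (coeff-⊛ f f′ k)) (Monicˢ-*ˢ d e (coeff f) (coeff f′) monf monf′))
    (≈ˢ-trans (≗⇒≈ˢ regroup) (≈ˢ-trans (*ˢ-≈ˢ fg≈P fg≈Q) (≗⇒≈ˢ (λ k → sym (coeff-⊛ P Q k)))))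
  where
  regroup : coeff (f ⊛ f′) *ˢ coeff (g ⊛ g′) ≗ (coeff f *ˢ coeff g) *ˢ (coeff f′ *ˢ coeff g′)
  regroup k = trans (*ˢ-cong (coeff-⊛ f f′) (coeff-⊛ g g′) k)
                    (*ˢ-interchange (coeff f) (coeff f′) (coeff g) (coeff g′) k)

MonicFactor-inflate : ∀ m → MonicFactor p P d → MonicFactor p (inflate m P) (d ℕ.* suc m)
MonicFactor-inflate {P = P} {d = d} m (monicFactor f g monf fg≈P) =
  monicFactor (inflate m f) (inflate m g)
    (Monicˢ-cong (λ k → sym (coeff-inflate m f k)) (Monicˢ-stretch d m (coeff f) monf))
    (≈ˢ-trans (≗⇒≈ˢ (λ k → sym (inflate-⊛ m f g k)))
      (inflate-≈ˢ m (f ⊛ g) P (≈ˢ-trans (≗⇒≈ˢ (coeff-⊛ f g)) fg≈P)))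

decompose : ∀ t₁ u t₂ j → u ℕ.≤ suc t₁ → j ℕ.≤ t₁ ℕ.+ u ℕ.* t₂ →
            ∃ λ a → ∃ λ b → a ℕ.≤ t₁ × b ℕ.≤ t₂ × j ≡ a ℕ.+ u ℕ.* b
decompose t₁ u zero j u≤ j≤ =
  j , 0 , subst (j ℕ.≤_) (+u*0 t₁ u) j≤ , z≤n , sym (+u*0 j u)
  where
  +u*0 : ∀ a u → a ℕ.+ u ℕ.* 0 ≡ a
  +u*0 = ℕ-Solver.solve-∀
decompose t₁ u (suc t₂) j u≤ j≤ with j ℕ.≤? t₁ ℕ.+ u ℕ.* t₂
... | yes j≤′ = let a , b , a≤ , b≤ , j≡ = decompose t₁ u t₂ j u≤ j≤′
                in a , b , a≤ , ℕₚ.m≤n⇒m≤1+n b≤ , j≡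
... | no j≰′  = let a , b , a≤ , b≤ , j∸u≡ = decompose t₁ u t₂ (j ∸ u) u≤ j∸u≤
                in a , suc b , a≤ , s≤s b≤ , trans (sym (ℕₚ.m∸n+n≡m u≤j)) (trans (cong (ℕ._+ u) j∸u≡) (refold a u b))
  where
  unfold : ∀ t₁ u t₂ → t₁ ℕ.+ u ℕ.* suc t₂ ≡ u ℕ.+ (t₁ ℕ.+ u ℕ.* t₂)
  unfold = ℕ-Solver.solve-∀
  refold : ∀ a u b → a ℕ.+ u ℕ.* b ℕ.+ u ≡ a ℕ.+ u ℕ.* suc b
  refold = ℕ-Solver.solve-∀
  u≤j : u ℕ.≤ j
  u≤j = ℕₚ.≤-trans u≤ (ℕₚ.≤-trans (s≤s (ℕₚ.m≤m+n t₁ (u ℕ.* t₂))) (ℕₚ.≰⇒> j≰′))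
  j∸u≤ : j ∸ u ℕ.≤ t₁ ℕ.+ u ℕ.* t₂
  j∸u≤ = ℕₚ.m≤n+o⇒m∸n≤o j u (subst (j ℕ.≤_) (unfold t₁ u t₂) j≤)

FactorLadder : ℕ → Poly → ℕ → ℕ → Set
FactorLadder p P s t = ∀ j → j ℕ.≤ t → MonicFactor p P (j ℕ.* s)

HasAllFactorDegrees : ℕ → ℕ → Set
HasAllFactorDegrees p n = FactorLadder p (xⁿ-1 n) 1 n

FactorLadder-⊛ : ∀ s t₁ u t₂ → FactorLadder p P s t₁ → FactorLadder p Q (u ℕ.* s) t₂ → u ℕ.≤ suc t₁ →
                 FactorLadder p (P ⊛ Q) s (t₁ ℕ.+ u ℕ.* t₂)
FactorLadder-⊛ s t₁ u t₂ LP LQ u≤ j j≤ =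
  let a , b , a≤ , b≤ , j≡ = decompose t₁ u t₂ j u≤ j≤
  in subst (MonicFactor _ _) (sym (trans (cong (ℕ._* s) j≡) (distrib a u b s))) (MonicFactor-⊛ (LP a a≤) (LQ b b≤))
  where
  distrib : ∀ a u b s → (a ℕ.+ u ℕ.* b) ℕ.* s ≡ a ℕ.* s ℕ.+ b ℕ.* (u ℕ.* s)
  distrib = ℕ-Solver.solve-∀

FactorLadder-self : ∀ p P d → Monicˢ d (coeff P) → FactorLadder p P d 1
FactorLadder-self p P d monic zero          _         = MonicFactor-one p P
FactorLadder-self p P d monic (suc zero)    _         =
  subst (MonicFactor p P) (sym (ℕₚ.+-identityʳ d)) (MonicFactor-self p P monic)
FactorLadder-self p P d monic (suc (suc j)) (s≤s ())

FactorLadder-≈ˢ : ∀ {s t} → coeff P ≈ˢ coeff Q [mod p ] → FactorLadder p P s t → FactorLadder p Q s t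
FactorLadder-≈ˢ P≈Q LP j j≤ = MonicFactor-≈ˢ P≈Q (LP j j≤)

FactorLadder-inflate : ∀ s t m → FactorLadder p P s t → FactorLadder p (inflate m P) (s ℕ.* suc m) t
FactorLadder-inflate s t m LP j j≤ =
  subst (MonicFactor _ _) (ℕₚ.*-assoc j s (suc m)) (MonicFactor-inflate m (LP j j≤))

infixr 25 _^ᴾ_
_^ᴾ_ : Poly → ℕ → Poly
f ^ᴾ zero  = 1ᴾ
f ^ᴾ suc n = f ⊛ (f ^ᴾ n)

FactorLadder-^ᴾ : ∀ s → FactorLadder p P s 1 → ∀ n → FactorLadder p (P ^ᴾ n) s n
FactorLadder-^ᴾ s LP zero    zero _ = MonicFactor-one _ _
FactorLadder-^ᴾ s LP (suc n) =
  subst (FactorLadder _ _ s) (cong suc (ℕₚ.*-identityˡ n))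
    (FactorLadder-⊛ s 1 1 n LP (subst (λ s′ → FactorLadder _ _ s′ n) (sym (ℕₚ.*-identityˡ s)) (FactorLadder-^ᴾ s LP n))
      (s≤s z≤n))

HasAllFactorDegrees⇒IsPPractical : ∀ {n} → 1 < p → HasAllFactorDegrees p n → IsPPractical p n
HasAllFactorDegrees⇒IsPPractical {p} {n} 1<p L d _ d≤n with L d d≤n
... | monicFactor f g monic fg≈ = f , (leading , above) , (g , f⊛g≈xⁿ-1)
  where
  monic′ : Monicˢ d (coeff f)
  monic′ = subst (λ d′ → Monicˢ d′ (coeff f)) (ℕₚ.*-identityʳ d) monic
  leading : ¬ (coeff f d ≡ + 0 [mod p ])
  leading p∣1 = ℕₚ.<⇒≢ 1<p (sym (ℕ∣.∣1⇒≡1 (subst (λ c → + p ℤ∣.∣ c - + 0) (proj₁ monic′) p∣1)))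
  above : ∀ k → d < k → coeff f k ≡ + 0 [mod p ]
  above k d<k = subst (λ c → + p ℤ∣.∣ c - + 0) (sym (proj₂ monic′ k d<k)) (p ℕ∣.∣0)
  f⊛g≈xⁿ-1 : (f ⊛ g) ≈ xⁿ-1 n [mod p ]
  f⊛g≈xⁿ-1 k = ∣⇒∣ᵤ (subst (λ c → + p ∣ c - coeff (xⁿ-1 n) k) (sym (coeff-⊛ f g k)) (coeff-∣ fg≈ k))

[k+1]*[n+1]C[k+1]≡[n+1]*nCk : ∀ n k → suc k ℕ.* (suc n C suc k) ≡ suc n ℕ.* (n C k)
[k+1]*[n+1]C[k+1]≡[n+1]*nCk n       zero    =
  trans (ℕₚ.*-identityˡ _) (trans (nC1≡n (suc n)) (sym (ℕₚ.*-identityʳ _)))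
[k+1]*[n+1]C[k+1]≡[n+1]*nCk zero    (suc k) = ℕₚ.*-zeroʳ (suc (suc k))
[k+1]*[n+1]C[k+1]≡[n+1]*nCk (suc n) (suc k) = begin
  suc (suc k) ℕ.* (suc (suc n) C suc (suc k))
    ≡⟨ cong (suc (suc k) ℕ.*_) (nCk+nC[k+1]≡[n+1]C[k+1] (suc n) (suc k)) ⟨
  suc (suc k) ℕ.* (a ℕ.+ b)
    ≡⟨ expand k a b ⟩
  a ℕ.+ suc k ℕ.* a ℕ.+ suc (suc k) ℕ.* b
    ≡⟨ cong₂ (λ x y → a ℕ.+ x ℕ.+ y) ([k+1]*[n+1]C[k+1]≡[n+1]*nCk n k) ([k+1]*[n+1]C[k+1]≡[n+1]*nCk n (suc k)) ⟩
  a ℕ.+ suc n ℕ.* (n C k) ℕ.+ suc n ℕ.* (n C suc k)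
    ≡⟨ collect n a (n C k) (n C suc k) ⟩
  a ℕ.+ suc n ℕ.* (n C k ℕ.+ n C suc k)
    ≡⟨ cong (λ c → a ℕ.+ suc n ℕ.* c) (nCk+nC[k+1]≡[n+1]C[k+1] n k) ⟩
  suc (suc n) ℕ.* a ∎
  where
  open ≡-Reasoning
  a = suc n C suc k
  b = suc n C suc (suc k)
  expand : ∀ k a b → suc (suc k) ℕ.* (a ℕ.+ b) ≡ a ℕ.+ suc k ℕ.* a ℕ.+ suc (suc k) ℕ.* b
  expand = ℕ-Solver.solve-∀
  collect : ∀ n a c d → a ℕ.+ suc n ℕ.* c ℕ.+ suc n ℕ.* d ≡ a ℕ.+ suc n ℕ.* (c ℕ.+ d)
  collect = ℕ-Solver.solve-∀

prime∣pCk : Prime p → ∀ k → 0 < k → k < p → p ℕ∣.∣ p C k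
prime∣pCk {suc n} pr (suc k) _ k<p with euclidsLemma (suc k) (suc n C suc k) pr
  (ℕ∣.divides (n C k) (trans ([k+1]*[n+1]C[k+1]≡[n+1]*nCk n k) (ℕₚ.*-comm (suc n) (n C k))))
... | inj₁ p∣k = ⊥-elim (ℕₚ.<⇒≱ k<p (ℕ∣.∣⇒≤ p∣k))
... | inj₂ p∣C = p∣C

x-1 : Poly
x-1 = xⁿ-1 1

-1^[n+1+k] : ∀ n k → -1ℤ ^ (n ℕ.+ suc k) ≡ -1ℤ * -1ℤ ^ (n ℕ.+ k)
-1^[n+1+k] n k = cong (-1ℤ ^_) (ℕₚ.+-suc n k)

-1^[n+n] : ∀ n → -1ℤ ^ (n ℕ.+ n) ≡ + 1
-1^[n+n] zero    = refl
-1^[n+n] (suc n) = begin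
  -1ℤ * -1ℤ ^ (n ℕ.+ suc n)       ≡⟨ cong (-1ℤ *_) (-1^[n+1+k] n n) ⟩
  -1ℤ * (-1ℤ * -1ℤ ^ (n ℕ.+ n))   ≡⟨ cong (λ s → -1ℤ * (-1ℤ * s)) (-1^[n+n] n) ⟩
  + 1                             ∎
  where open ≡-Reasoning

-1^n≡-1⊎2∣n : ∀ n → -1ℤ ^ n ≡ -1ℤ ⊎ 2 ℕ∣.∣ n
-1^n≡-1⊎2∣n zero          = inj₂ (2 ℕ∣.∣0)
-1^n≡-1⊎2∣n (suc zero)    = inj₁ refl
-1^n≡-1⊎2∣n (suc (suc n)) with -1^n≡-1⊎2∣n n
... | inj₁ eq  = inj₁ (trans (sym (ℤₚ.*-assoc -1ℤ -1ℤ (-1ℤ ^ n))) (trans (ℤₚ.*-identityˡ (-1ℤ ^ n)) eq))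
... | inj₂ 2∣n = inj₂ (ℕ∣.∣m∣n⇒∣m+n (ℕ∣.∣-refl {2}) 2∣n)

coeff-x-1^ᴾ : ∀ n k → coeff (x-1 ^ᴾ n) k ≡ -1ℤ ^ (n ℕ.+ k) * + (n C k)
coeff-x-1^ᴾ zero    zero    = refl
coeff-x-1^ᴾ zero    (suc k) = sym (ℤₚ.*-zeroʳ (-1ℤ ^ suc k))
coeff-x-1^ᴾ (suc n) zero    = begin
  coeff (x-1 ⊛ (x-1 ^ᴾ n)) 0                  ≡⟨ coeff-⊛ x-1 (x-1 ^ᴾ n) 0 ⟩
  -1ℤ * coeff (x-1 ^ᴾ n) 0                    ≡⟨ cong (-1ℤ *_) (coeff-x-1^ᴾ n 0) ⟩
  -1ℤ * (-1ℤ ^ (n ℕ.+ 0) * + (n C 0))         ≡⟨ ℤₚ.*-assoc -1ℤ (-1ℤ ^ (n ℕ.+ 0)) (+ 1) ⟨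
  -1ℤ ^ (suc n ℕ.+ 0) * + (suc n C 0)         ∎
  where open ≡-Reasoning
coeff-x-1^ᴾ (suc n) (suc k) = begin
  coeff (x-1 ⊛ (x-1 ^ᴾ n)) (suc k)
    ≡⟨ coeff-⊛ x-1 (x-1 ^ᴾ n) (suc k) ⟩
  -1ℤ * coeff (x-1 ^ᴾ n) (suc k) + (coeff 1ᴾ *ˢ coeff (x-1 ^ᴾ n)) k
    ≡⟨ cong (_+_ (-1ℤ * coeff (x-1 ^ᴾ n) (suc k)))
            (trans (*ˢ-congˡ coeff-1ᴾ k) (*ˢ-identityˡ (coeff (x-1 ^ᴾ n)) k)) ⟩
  -1ℤ * coeff (x-1 ^ᴾ n) (suc k) + coeff (x-1 ^ᴾ n) k
    ≡⟨ cong₂ (λ a b → -1ℤ * a + b) (coeff-x-1^ᴾ n (suc k)) (coeff-x-1^ᴾ n k) ⟩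
  -1ℤ * (-1ℤ ^ (n ℕ.+ suc k) * + (n C suc k)) + s * + (n C k)
    ≡⟨ cong (λ t → -1ℤ * (t * + (n C suc k)) + s * + (n C k)) (-1^[n+1+k] n k) ⟩
  -1ℤ * ((-1ℤ * s) * + (n C suc k)) + s * + (n C k)
    ≡⟨ pascal-sign s (+ (n C k)) (+ (n C suc k)) ⟩
  -1ℤ * (-1ℤ * s) * (+ (n C k) + + (n C suc k))
    ≡⟨ cong₂ _*_ (cong (-1ℤ *_) (-1^[n+1+k] n k)) (ℤₚ.pos-+ (n C k) (n C suc k)) ⟨
  -1ℤ * -1ℤ ^ (n ℕ.+ suc k) * + (n C k ℕ.+ n C suc k)
    ≡⟨ cong (λ c → -1ℤ * -1ℤ ^ (n ℕ.+ suc k) * + c) (nCk+nC[k+1]≡[n+1]C[k+1] n k) ⟩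
  -1ℤ ^ (suc n ℕ.+ suc k) * + (suc n C suc k) ∎
  where
  open ≡-Reasoning
  s = -1ℤ ^ (n ℕ.+ k)
  pascal-sign : ∀ s a b → -1ℤ * ((-1ℤ * s) * b) + s * a ≡ -1ℤ * (-1ℤ * s) * (a + b)
  pascal-sign = solve-∀

monomial-diag : ∀ n → monomial n n ≡ + 1
monomial-diag zero    = refl
monomial-diag (suc n) = monomial-diag n

monomial-off : ∀ n k → k ≢ n → monomial n k ≡ + 0
monomial-off zero    zero    k≢n = ⊥-elim (k≢n refl)
monomial-off zero    (suc k) k≢n = refl
monomial-off (suc n) zero    k≢n = refl
monomial-off (suc n) (suc k) k≢n = monomial-off n k (λ eq → k≢n (cong suc eq))

-- The binomial coefficients strictly between 0 and p vanish mod p; at the ends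
-- (−1)^p ≡ −1 (an odd power unless p = 2) and (−1)^(2p) = 1.
frobenius-x-1 : Prime p → coeff (x-1 ^ᴾ p) ≈ˢ coeff (xⁿ-1 p) [mod p ]
frobenius-x-1 {p@(suc _)} pr = mk≈ˢ λ k →
  subst (_ ∣_) (cong₂ _-_ (sym (coeff-x-1^ᴾ p k)) (sym (coeff-xⁿ-1 p k))) (coefficient k)
  where
  coefficient : ∀ k → + p ∣ -1ℤ ^ (p ℕ.+ k) * + (p C k) - (monomial p k + -1ˢ k)
  coefficient k with ℕₚ.<-cmp k p
  coefficient zero | tri< _ _ _ with -1^n≡-1⊎2∣n (p ℕ.+ 0)
  ... | inj₁ odd = ≡0⇒∣ (cong (λ s → s * + 1 - (+ 0 + -1ℤ)) odd)
  ... | inj₂ 2∣p with prime⇒irreducible pr (subst (2 ℕ∣.∣_) (ℕₚ.+-identityʳ p) 2∣p)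
  ...   | inj₂ refl = divides (+ 1) refl
  coefficient (suc k) | tri< k<p _ _ =
    subst (_ ∣_) (sym (trans (cong (λ c → s * + (p C suc k) - (c + + 0)) (monomial-off p (suc k) (ℕₚ.<⇒≢ k<p)))
                             (ℤₚ.+-identityʳ _)))
      (∣n⇒∣m*n s (∣ᵤ⇒∣ (prime∣pCk pr (suc k) (s≤s z≤n) k<p)))
    where s = -1ℤ ^ (p ℕ.+ suc k)
  coefficient k | tri≈ _ refl _ =
    ≡0⇒∣ (trans (cong₂ (λ s c → s * + c - (monomial p p + + 0)) (-1^[n+n] p) (nCn≡1 p))
                (cong (λ c → + 1 * + 1 - (c + + 0)) (monomial-diag p)))
  coefficient (suc k) | tri> _ _ p<k =
    ≡0⇒∣ (trans (cong₂ (λ c m → -1ℤ ^ (p ℕ.+ suc k) * + c - (m + + 0)) (k>n⇒nCk≡0 p<k)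
                       (monomial-off p (suc k) (ℕₚ.>⇒≢ p<k)))
                (cong (_- + 0) (ℤₚ.*-zeroʳ (-1ℤ ^ (p ℕ.+ suc k)))))

inflate-factorisation : ∀ n b m A → coeff (xⁿ-1 n) ≈ˢ coeff (xⁿ-1 b ⊛ A) [mod p ] →
  coeff (xⁿ-1 (n ℕ.* suc m)) ≈ˢ coeff (xⁿ-1 (b ℕ.* suc m) ⊛ inflate m A) [mod p ]
inflate-factorisation n b m A eq =
  ≈ˢ-trans (≗⇒≈ˢ (λ k → sym (inflate-xⁿ-1 m n k)))
    (≈ˢ-trans (inflate-≈ˢ m (xⁿ-1 n) (xⁿ-1 b ⊛ A) eq) (≗⇒≈ˢ inflated))
  where
  inflated : coeff (inflate m (xⁿ-1 b ⊛ A)) ≗ coeff (xⁿ-1 (b ℕ.* suc m) ⊛ inflate m A)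
  inflated k = trans (inflate-⊛ m (xⁿ-1 b) A k)
    (trans (*ˢ-congˡ (inflate-xⁿ-1 m b) k) (sym (coeff-⊛ (xⁿ-1 (b ℕ.* suc m)) (inflate m A) k)))

-- If x^(cb) − 1 ≡ (x^b − 1)·A, then x^(cbN) − 1 ≡ (x^(bN) − 1)·A(x^N), whose ladder of factors has
-- step N up to bN and then step sN up to bN + sNt = cbN.
HasAllFactorDegrees-scale : ∀ b c s t A → s ℕ.≤ b → c ℕ.* b ≡ b ℕ.+ s ℕ.* t →
  coeff (xⁿ-1 (c ℕ.* b)) ≈ˢ coeff (xⁿ-1 b ⊛ A) [mod p ] → FactorLadder p A s t →
  ∀ m → HasAllFactorDegrees p (b ℕ.* suc m) → HasAllFactorDegrees p (c ℕ.* b ℕ.* suc m)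
HasAllFactorDegrees-scale {p = p} b c s t A s≤b cb≡ eq LA m LB =
  FactorLadder-≈ˢ (≈ˢ-sym (inflate-factorisation (c ℕ.* b) b m A eq))
    (subst (FactorLadder p (xⁿ-1 (b ℕ.* suc m) ⊛ inflate m A) 1) degree
      (FactorLadder-⊛ 1 (b ℕ.* N) (s ℕ.* N) t LB
        (subst (λ s′ → FactorLadder p (inflate m A) s′ t) (sym (ℕₚ.*-identityʳ (s ℕ.* N))) (FactorLadder-inflate s t m LA))
        (ℕₚ.m≤n⇒m≤1+n (ℕₚ.*-monoˡ-≤ N s≤b))))
  where
  N = suc m
  degree : b ℕ.* N ℕ.+ s ℕ.* N ℕ.* t ≡ c ℕ.* b ℕ.* N
  degree = trans (regroup b s N t) (sym (cong (ℕ._* N) cb≡))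
    where
    regroup : ∀ b s N t → b ℕ.* N ℕ.+ s ℕ.* N ℕ.* t ≡ (b ℕ.+ s ℕ.* t) ℕ.* N
    regroup = ℕ-Solver.solve-∀

HasAllFactorDegrees-iterate : ∀ b c s t A → .{{NonZero c}} → s ℕ.≤ b → c ℕ.* b ≡ b ℕ.+ s ℕ.* t →
  coeff (xⁿ-1 (c ℕ.* b)) ≈ˢ coeff (xⁿ-1 b ⊛ A) [mod p ] → FactorLadder p A s t →
  HasAllFactorDegrees p b → ∀ J → HasAllFactorDegrees p (b ℕ.* c ℕ.^ J)
HasAllFactorDegrees-iterate b c s t A s≤b cb≡ eq LA LB zero =
  subst (HasAllFactorDegrees _) (sym (ℕₚ.*-identityʳ b)) LB
HasAllFactorDegrees-iterate b c s t A s≤b cb≡ eq LA LB (suc J) =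
  subst (HasAllFactorDegrees _) degree
    (HasAllFactorDegrees-scale b c s t A s≤b cb≡ eq LA (ℕ.pred N)
      (subst (HasAllFactorDegrees _) (cong (b ℕ.*_) (sym (ℕₚ.suc-pred N)))
        (HasAllFactorDegrees-iterate b c s t A s≤b cb≡ eq LA LB J)))
  where
  N = c ℕ.^ J
  instance _ = ℕₚ.m^n≢0 c J
  degree : c ℕ.* b ℕ.* suc (ℕ.pred N) ≡ b ℕ.* (c ℕ.* N)
  degree = trans (cong (c ℕ.* b ℕ.*_) (ℕₚ.suc-pred N)) (swap c b N)
    where
    swap : ∀ c b N → c ℕ.* b ℕ.* N ≡ b ℕ.* (c ℕ.* N)
    swap = ℕ-Solver.solve-∀

x-1-monic : Monicˢ 1 (coeff x-1)
x-1-monic = refl , λ { (suc zero) (s≤s ()) ; (suc (suc k)) _ → refl }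

primePower-ladder : Prime p → ∀ J → HasAllFactorDegrees p (p ℕ.^ J)
primePower-ladder {p@(suc p′)} pr J =
  subst (HasAllFactorDegrees _) (ℕₚ.*-identityˡ (p ℕ.^ J))
    (HasAllFactorDegrees-iterate 1 p 1 p′ (x-1 ^ᴾ p′) ℕₚ.≤-refl (trans (ℕₚ.*-identityʳ p) (cong suc (sym (ℕₚ.*-identityˡ p′))))
      (subst (λ n → coeff (xⁿ-1 n) ≈ˢ coeff (x-1 ^ᴾ p) [mod p ]) (sym (ℕₚ.*-identityʳ p)) (≈ˢ-sym (frobenius-x-1 pr)))
      (FactorLadder-^ᴾ 1 x-1-ladder p′) x-1-ladder J)
  where
  x-1-ladder : FactorLadder p x-1 1 1
  x-1-ladder = FactorLadder-self p x-1 1 x-1-monic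

coeff-All : ∀ {P : ℤ → Set} → P (+ 0) → ∀ {L} → All P L → ∀ k → P (coeff L k)
coeff-All P0 []         k       = P0
coeff-All P0 (Pa ∷ PL) zero    = Pa
coeff-All P0 (Pa ∷ PL) (suc k) = coeff-All P0 PL k

≈ˢ-by-computation : ∀ q f g → True (all? (+ q ∣?_) (f ⊕ map (-1ℤ *_) g)) → coeff f ≈ˢ coeff g [mod q ]
≈ˢ-by-computation q f g check = mk≈ˢ λ k →
  subst (_ ∣_) (trans (coeff-⊕ f (map (-1ℤ *_) g) k)
                      (cong (_+_ (coeff f k)) (trans (coeff-map-* -1ℤ g k) (ℤₚ.-1*i≡-i (coeff g k)))))
    (coeff-All ∣0 (toWitness check) k)

square-ladder : ∀ v → FactorLadder p (monicOf v ^ᴾ 2) (length v) 2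
square-ladder v = FactorLadder-^ᴾ (length v) (FactorLadder-self _ (monicOf v) (length v) (monicOf-monic v)) 2

-- Over 𝔽₂: x¹⁴ − 1 = ((x + 1)(x³ + x + 1)(x³ + x² + 1))², and x⁷⁰ − 1 = (x¹⁴ − 1)·A where
-- A = (Φ₅ h₁ h₂)², Φ₅ = x⁴ + x³ + x² + x + 1 and h₁ h₂ = Φ₃₅, with h₁ and h₂ of degree 12.
x+1 c₁ c₂ Φ₅ h₁ h₂ : List ℤ
x+1 = + 1 ∷ []
c₁  = + 1 ∷ + 1 ∷ + 0 ∷ []
c₂  = + 1 ∷ + 0 ∷ + 1 ∷ []
Φ₅  = + 1 ∷ + 1 ∷ + 1 ∷ + 1 ∷ []
h₁  = + 1 ∷ + 1 ∷ + 1 ∷ + 0 ∷ + 1 ∷ + 0 ∷ + 0 ∷ + 1 ∷ + 1 ∷ + 1 ∷ + 1 ∷ + 0 ∷ []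
h₂  = + 1 ∷ + 0 ∷ + 1 ∷ + 1 ∷ + 1 ∷ + 1 ∷ + 0 ∷ + 0 ∷ + 1 ∷ + 0 ∷ + 1 ∷ + 1 ∷ []

x¹⁴-1-factors A₇₀ : Poly
x¹⁴-1-factors = monicOf x+1 ^ᴾ 2 ⊛ (monicOf c₁ ^ᴾ 2 ⊛ monicOf c₂ ^ᴾ 2)
A₇₀           = monicOf Φ₅ ^ᴾ 2 ⊛ (monicOf h₁ ^ᴾ 2 ⊛ monicOf h₂ ^ᴾ 2)

x¹⁴-1-ladder : HasAllFactorDegrees 2 14
x¹⁴-1-ladder =
  FactorLadder-≈ˢ (≈ˢ-sym (≈ˢ-by-computation 2 (xⁿ-1 14) x¹⁴-1-factors tt))
    (FactorLadder-⊛ 1 2 3 4 (square-ladder x+1)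
      (FactorLadder-⊛ 3 2 1 2 (square-ladder c₁) (square-ladder c₂) (s≤s z≤n))
      (s≤s (s≤s (s≤s z≤n))))

A₇₀-ladder : FactorLadder 2 A₇₀ 4 14
A₇₀-ladder =
  FactorLadder-⊛ 4 2 3 4 (square-ladder Φ₅)
    (FactorLadder-⊛ 12 2 1 2 (square-ladder h₁) (square-ladder h₂) (s≤s z≤n))
    (s≤s (s≤s (s≤s z≤n)))

14·5^J-ladder : ∀ J → HasAllFactorDegrees 2 (14 ℕ.* 5 ℕ.^ J)
14·5^J-ladder = HasAllFactorDegrees-iterate 14 5 4 14 A₇₀ (ℕₚ.m≤m+n 4 10) refl
  (≈ˢ-by-computation 2 (xⁿ-1 70) (xⁿ-1 14 ⊛ A₇₀) tt) A₇₀-ladder x¹⁴-1-ladder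

reduce : ∀ q .{{_ : NonZero q}} → ℤ → ℤ
reduce q a = + (a %ℕ q)

reduce-∣ : ∀ q .{{_ : NonZero q}} a → + q ∣ reduce q a - a
reduce-∣ q a = divides (- (a /ℕ q)) (trans (cong (_-_ (reduce q a)) (a≡a%ℕn+[a/ℕn]*n a q)) (cancel (reduce q a) (a /ℕ q) (+ q)))
  where
  cancel : ∀ r t q → r - (r + t * q) ≡ - t * q
  cancel = solve-∀

coeff-applyUpTo-< : ∀ h d k → k < d → coeff (applyUpTo h d) k ≡ h k
coeff-applyUpTo-< h (suc d) zero    _         = refl
coeff-applyUpTo-< h (suc d) (suc k) (s≤s k<d) = coeff-applyUpTo-< (λ i → h (suc i)) d k k<d

coeff-applyUpTo-≥ : ∀ h d k → d ℕ.≤ k → coeff (applyUpTo h d) k ≡ + 0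
coeff-applyUpTo-≥ h zero    k       _         = refl
coeff-applyUpTo-≥ h (suc d) (suc k) (s≤s d≤k) = coeff-applyUpTo-≥ (λ i → h (suc i)) d k d≤k

coeff-applyUpTo-0 : ∀ h n → (∀ i → h i ≡ + 0) → ∀ k → coeff (applyUpTo h n) k ≡ + 0
coeff-applyUpTo-0 h zero    h≡0 k       = refl
coeff-applyUpTo-0 h (suc n) h≡0 zero    = h≡0 0
coeff-applyUpTo-0 h (suc n) h≡0 (suc k) = coeff-applyUpTo-0 (λ i → h (suc i)) n (λ i → h≡0 (suc i)) k

coeff-≥length : ∀ f k → length f ℕ.≤ k → coeff f k ≡ + 0
coeff-≥length []      k       _         = refl
coeff-≥length (a ∷ f) (suc k) (s≤s f≤k) = coeff-≥length f k f≤k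

*ˢ-monic-top : ∀ d F U j → Monicˢ d F → (∀ k → j < k → + p ∣ U k) → + p ∣ (F *ˢ U) (j ℕ.+ d) - U j
*ˢ-monic-top zero F U j monF _ =
  subst (_ ∣_) (sym (cong (_- U j) (trans (cong (F *ˢ U) (ℕₚ.+-identityʳ j))
                                          (trans (*ˢ-congˡ (Monicˢ-zero monF) j) (*ˢ-identityˡ U j)))))
    (∣-self-diff (U j))
*ˢ-monic-top (suc d) F U j monF U-above =
  subst (_ ∣_) (sym (trans (cong (λ i → (F *ˢ U) i - U j) (ℕₚ.+-suc j d)) (regroup (F 0) _ _ (U j))))
    (∣m∣n⇒∣m+n (∣n⇒∣m*n (F 0) (U-above (suc (j ℕ.+ d)) (s≤s (ℕₚ.m≤m+n j d))))
               (*ˢ-monic-top d (tail F) U j (Monicˢ-tail monF) U-above))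
  where
  regroup : ∀ a b c u → a * b + c - u ≡ a * b + (c - u)
  regroup = solve-∀

monic-*ˢ-vanishing : ∀ d F U B → Monicˢ d F → (∀ k → B ℕ.≤ k → U k ≡ + 0) →
                     (∀ k → d ℕ.≤ k → + p ∣ (F *ˢ U) k) → ∀ j → + p ∣ U j
monic-*ˢ-vanishing {p} d F U B monF U-support FU-high j = below B j (ℕₚ.m≤n+m B j)
  where
  below : ∀ t j → B ℕ.≤ j ℕ.+ t → + p ∣ U j
  below zero    j B≤j = subst (_ ∣_) (sym (U-support j (subst (B ℕ.≤_) (ℕₚ.+-identityʳ j) B≤j))) ∣0
  below (suc t) j B≤ =
    subst (_ ∣_) (cancel ((F *ˢ U) (j ℕ.+ d)) (U j))
      (∣m∣n⇒∣m+n (FU-high (j ℕ.+ d) (ℕₚ.m≤n+m d j))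
                 (∣m⇒∣-m (*ˢ-monic-top d F U j monF (λ k j<k → below t k (B≤k+t k j<k)))))
    where
    B≤k+t : ∀ k → j < k → B ℕ.≤ k ℕ.+ t
    B≤k+t k j<k = ℕₚ.≤-trans B≤ (subst (ℕ._≤ k ℕ.+ t) (sym (ℕₚ.+-suc j t)) (ℕₚ.+-monoˡ-≤ t j<k))
    cancel : ∀ a u → a + - (a - u) ≡ u
    cancel = solve-∀

module PowerRemainder (q d′ : ℕ) .{{_ : NonZero q}} (v : List ℤ) where

  Fᵥ : Series
  Fᵥ = coeff (monicOf v)

  -- x·R − c·F with c the top coefficient of R: the remainder of x·R, reduced into [0, q).
  nextCoeff : List ℤ → ℕ → ℤ
  nextCoeff s k = reduce q (coeff (+ 0 ∷ s) k - coeff s d′ * Fᵥ k)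

  next : List ℤ → List ℤ
  next s = applyUpTo (nextCoeff s) (suc d′)

  xpowRem : ℕ → List ℤ
  xpowRem zero    = applyUpTo 1ˢ (suc d′)
  xpowRem (suc n) = next (xpowRem n)

  xpowRem-support : ∀ n k → suc d′ ℕ.≤ k → coeff (xpowRem n) k ≡ + 0
  xpowRem-support zero    = coeff-applyUpTo-≥ 1ˢ (suc d′)
  xpowRem-support (suc n) = coeff-applyUpTo-≥ (nextCoeff (xpowRem n)) (suc d′)

  xpowRem-zero : coeff (xpowRem 0) ≗ 1ˢ
  xpowRem-zero zero    = refl
  xpowRem-zero (suc k) = coeff-applyUpTo-0 (λ i → 1ˢ (suc i)) d′ (λ _ → refl) k

  xpowRem-+period : ∀ K → xpowRem K ≡ xpowRem 0 → ∀ n → xpowRem (n ℕ.+ K) ≡ xpowRem n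
  xpowRem-+period K period zero    = period
  xpowRem-+period K period (suc n) = cong next (xpowRem-+period K period n)

  xpowRem-mod : ∀ K .{{_ : NonZero K}} → xpowRem K ≡ xpowRem 0 → ∀ n → xpowRem n ≡ xpowRem (n ℕ.% K)
  xpowRem-mod K period n =
    trans (cong xpowRem (m≡m%n+[m/n]*n n K)) (multiples (n ℕ.% K) (n ℕ./ K))
    where
    multiples : ∀ r m → xpowRem (r ℕ.+ m ℕ.* K) ≡ xpowRem r
    multiples r zero    = cong xpowRem (ℕₚ.+-identityʳ r)
    multiples r (suc m) =
      trans (cong xpowRem (trans (cong (r ℕ.+_) (ℕₚ.+-comm K (m ℕ.* K))) (sym (ℕₚ.+-assoc r (m ℕ.* K) K))))
            (trans (xpowRem-+period K period (r ℕ.+ m ℕ.* K)) (multiples r m))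

  module _ (length-v : length v ≡ suc d′) where

    Fᵥ-monic : Monicˢ (suc d′) Fᵥ
    Fᵥ-monic = subst (λ d → Monicˢ d Fᵥ) length-v (monicOf-monic v)

    coeff-next : ∀ s → (∀ k → suc d′ ℕ.≤ k → coeff s k ≡ + 0) →
                 coeff (next s) ≈ˢ shift (coeff s) +ˢ (- coeff s d′) •ˢ Fᵥ [mod q ]
    coeff-next s s-support = mk≈ˢ coefficient
      where
      c = coeff s d′
      coefficient : ∀ k → + q ∣ coeff (next s) k - (shift (coeff s) k + (- c) * Fᵥ k)
      coefficient k with ℕₚ.<-cmp k (suc d′)
      ... | tri< k<d _ _ =
        subst (_ ∣_) (cong₂ _-_ (sym (coeff-applyUpTo-< (nextCoeff s) (suc d′) k k<d))
                                (trans (cong (λ a → a - c * Fᵥ k) (shifted k)) (subtract (shift (coeff s) k) c (Fᵥ k))))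
          (reduce-∣ q (coeff (+ 0 ∷ s) k - c * Fᵥ k))
        where
        shifted : ∀ k → coeff (+ 0 ∷ s) k ≡ shift (coeff s) k
        shifted zero    = refl
        shifted (suc k) = refl
        subtract : ∀ a c f → a - c * f ≡ a + (- c) * f
        subtract = solve-∀
      ... | tri≈ _ refl _ =
        ≡0⇒∣ (trans (cong₂ (λ r f → r - (c + (- c) * f)) (coeff-applyUpTo-≥ (nextCoeff s) (suc d′) (suc d′) ℕₚ.≤-refl)
                                                          (proj₁ Fᵥ-monic))
                    (cancel c))
        where
        cancel : ∀ c → + 0 - (c + (- c) * + 1) ≡ + 0
        cancel = solve-∀
      ... | tri> _ _ (s≤s d≤k′) = ≡0⇒∣ (begin
        coeff (next s) k - (shift (coeff s) k + (- c) * Fᵥ k)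
          ≡⟨ cong₂ (λ r a → r - (a + (- c) * Fᵥ k))
                   (coeff-applyUpTo-≥ (nextCoeff s) (suc d′) k (ℕₚ.m≤n⇒m≤1+n d≤k′)) (s-support _ d≤k′) ⟩
        + 0 - (+ 0 + (- c) * Fᵥ k)
          ≡⟨ cong (λ f → + 0 - (+ 0 + (- c) * f)) (proj₂ Fᵥ-monic k (s≤s d≤k′)) ⟩
        + 0 - (+ 0 + (- c) * + 0)
          ≡⟨ cong (λ z → + 0 - (+ 0 + z)) (ℤₚ.*-zeroʳ (- c)) ⟩
        + 0 ∎)
        where open ≡-Reasoning

    xpowRem-spec : ∀ n → ∃ λ Q → monomial n ≈ˢ Fᵥ *ˢ coeff Q +ˢ coeff (xpowRem n) [mod q ]
    xpowRem-spec zero =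
      [] , ≗⇒≈ˢ (λ k → sym (trans (cong₂ _+_ (trans (*ˢ-comm Fᵥ 0ˢ k) (*ˢ-zeroˡ Fᵥ k)) (xpowRem-zero k))
                                 (ℤₚ.+-identityˡ _)))
    xpowRem-spec (suc n) with xpowRem-spec n
    ... | Q , xⁿ≈ = (c ∷ Q) , mk≈ˢ coefficient
      where
      R = xpowRem n
      c = coeff R d′
      F*cQ : ∀ k → (Fᵥ *ˢ coeff (c ∷ Q)) k ≡ c * Fᵥ k + (Fᵥ *ˢ shift (coeff Q)) k
      F*cQ k = begin
        (Fᵥ *ˢ coeff (c ∷ Q)) k                              ≡⟨ *ˢ-congʳ (coeff-∷ c Q) k ⟩
        (Fᵥ *ˢ (c •ˢ 1ˢ +ˢ shift (coeff Q))) k               ≡⟨ *ˢ-distribˡ-+ˢ Fᵥ (c •ˢ 1ˢ) (shift (coeff Q)) k ⟩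
        (Fᵥ *ˢ (c •ˢ 1ˢ)) k + (Fᵥ *ˢ shift (coeff Q)) k      ≡⟨ cong (_+ (Fᵥ *ˢ shift (coeff Q)) k) (*ˢ-•ˢ-comm c Fᵥ 1ˢ k) ⟩
        c * (Fᵥ *ˢ 1ˢ) k + (Fᵥ *ˢ shift (coeff Q)) k         ≡⟨ cong (λ a → c * a + (Fᵥ *ˢ shift (coeff Q)) k) (*ˢ-identityʳ Fᵥ k) ⟩
        c * Fᵥ k + (Fᵥ *ˢ shift (coeff Q)) k                 ∎
        where open ≡-Reasoning
      shifted : ∀ k → + q ∣ shift (monomial n) k - ((Fᵥ *ˢ shift (coeff Q)) k + shift (coeff R) k)
      shifted k = subst (_ ∣_) (cong (_-_ (shift (monomial n) k))
                                 (trans (shift-+ˢ (Fᵥ *ˢ coeff Q) (coeff R) k)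
                                        (cong (_+ shift (coeff R) k) (sym (*ˢ-shift Fᵥ (coeff Q) k)))))
                    (coeff-∣ (shift-≈ˢ xⁿ≈) k)
      coefficient : ∀ k → + q ∣ monomial (suc n) k - ((Fᵥ *ˢ coeff (c ∷ Q)) k + coeff (next R) k)
      coefficient k =
        subst (_ ∣_) (trans (regroup (shift (monomial n) k) ((Fᵥ *ˢ shift (coeff Q)) k) (shift (coeff R) k) (coeff (next R) k) c (Fᵥ k)) (cong (λ a → monomial (suc n) k - (a + coeff (next R) k)) (sym (F*cQ k))))
          (∣m∣n⇒∣m+n (shifted k) (∣m⇒∣-m (coeff-∣ (coeff-next R (xpowRem-support n)) k)))
        where
        regroup : ∀ x y r r′ c f → (x - (y + r)) + - (r′ - (r + (- c) * f)) ≡ x - ((c * f + y) + r′)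
        regroup = solve-∀

    -- If Fᵥ divides xⁿ − 1 then xⁿ ≡ 1 modulo Fᵥ: the cofactor difference Fᵥ·(G − Q) equals R − 1,
    -- which has degree below that of Fᵥ, so it vanishes.
    xpowRem-≈1 : ∀ n G → Fᵥ *ˢ coeff G ≈ˢ coeff (xⁿ-1 n) [mod q ] → coeff (xpowRem n) ≈ˢ 1ˢ [mod q ]
    xpowRem-≈1 n G FG≈ with xpowRem-spec n
    ... | Q , xⁿ≈ = mk≈ˢ λ k → subst (_ ∣_) (remainder k) (∣m∣n⇒∣m+n (∣m⇒∣-m (FU≈R-1 k)) (FU≈0 k))
      where
      R = coeff (xpowRem n)
      U′ = G ⊕ map (-1ℤ *_) Q
      U = coeff U′
      FU : ∀ k → (Fᵥ *ˢ U) k ≡ (Fᵥ *ˢ coeff G) k + -1ℤ * (Fᵥ *ˢ coeff Q) k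
      FU k = trans (*ˢ-congʳ (λ j → trans (coeff-⊕ G (map (-1ℤ *_) Q) j) (cong (_+_ (coeff G j)) (coeff-map-* -1ℤ Q j))) k)
               (trans (*ˢ-distribˡ-+ˢ Fᵥ (coeff G) (-1ℤ •ˢ coeff Q) k)
                      (cong (_+_ ((Fᵥ *ˢ coeff G) k)) (*ˢ-•ˢ-comm -1ℤ Fᵥ (coeff Q) k)))
      FU≈R-1 : ∀ k → + q ∣ (Fᵥ *ˢ U) k - (R k + -1ˢ k)
      FU≈R-1 k = subst (_ ∣_) (trans (cong (λ x → (g - x) + (monomial n k - ((Fᵥ *ˢ coeff Q) k + R k))) (coeff-xⁿ-1 n k)) (trans (regroup g (monomial n k) (-1ˢ k) ((Fᵥ *ˢ coeff Q) k) (R k)) (cong (_- (R k + -1ˢ k)) (sym (FU k)))))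
                   (∣m∣n⇒∣m+n (coeff-∣ FG≈ k) (coeff-∣ xⁿ≈ k))
        where
        g = (Fᵥ *ˢ coeff G) k
        regroup : ∀ g x m fq r → (g - (x + m)) + (x - (fq + r)) ≡ (g + -1ℤ * fq) - (r + m)
        regroup = solve-∀
      FU-high : ∀ k → suc d′ ℕ.≤ k → + q ∣ (Fᵥ *ˢ U) k
      FU-high (suc k) d≤k =
        subst (_ ∣_) (trans (cong (λ r → (Fᵥ *ˢ U) (suc k) - (r + + 0)) (xpowRem-support n (suc k) d≤k)) (ℤₚ.+-identityʳ _))
          (FU≈R-1 (suc k))
      FU≈0 : ∀ k → + q ∣ (Fᵥ *ˢ U) k
      FU≈0 k = subst (_ ∣_) (trans (cong (_-_ ((Fᵥ *ˢ U) k)) (trans (*ˢ-comm Fᵥ 0ˢ k) (*ˢ-zeroˡ Fᵥ k))) (ℤₚ.+-identityʳ _))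
        (coeff-∣ (*ˢ-≈ˢ {F = Fᵥ} ≈ˢ-refl (mk≈ˢ {G = 0ˢ} λ j → subst (_ ∣_) (sym (ℤₚ.+-identityʳ (U j)))
          (monic-*ˢ-vanishing (suc d′) Fᵥ U (length U′) Fᵥ-monic (coeff-≥length U′) FU-high j))) k)
      remainder : ∀ k → - ((Fᵥ *ˢ U) k - (R k + -1ˢ k)) + (Fᵥ *ˢ U) k ≡ R k - 1ˢ k
      remainder zero    = cancel ((Fᵥ *ˢ U) 0) (R 0)
        where
        cancel : ∀ a r → - (a - (r + -1ℤ)) + a ≡ r - + 1
        cancel = solve-∀
      remainder (suc k) = cancel ((Fᵥ *ˢ U) (suc k)) (R (suc k))
        where
        cancel : ∀ a r → - (a - (r + + 0)) + a ≡ r - + 0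
        cancel = solve-∀

AllReduced : ℕ → ℕ → (List ℤ → Set) → Set
AllReduced q zero    P = P []
AllReduced q (suc d) P = ∀ {r} → r < q → AllReduced q d (λ w → P (+ r ∷ w))

allReduced? : ∀ q d {P : List ℤ → Set} → (∀ w → Dec (P w)) → Dec (AllReduced q d P)
allReduced? q zero    P? = P? []
allReduced? q (suc d) P? = ℕₚ.allUpTo? (λ r → allReduced? q d (λ w → P? (+ r ∷ w))) q

AllReduced-applyUpTo : ∀ {q} d {P} → AllReduced q d P → ∀ (h : ℕ → ℕ) → (∀ i → h i < q) → P (applyUpTo (λ i → + h i) d)
AllReduced-applyUpTo zero    all h h<q = all
AllReduced-applyUpTo (suc d) all h h<q = AllReduced-applyUpTo d (all (h<q 0)) (λ i → h (suc i)) (λ i → h<q (suc i))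

UnitsSquareToOne : ℕ → Set
UnitsSquareToOne q = ∀ c → 0 < c → c < q → + q ∣ + c * + c - + 1

coeff-monicOf-< : ∀ v k → k < length v → coeff (monicOf v) k ≡ coeff v k
coeff-monicOf-< (a ∷ v) zero    _         = refl
coeff-monicOf-< (a ∷ v) (suc k) (s≤s k<v) = coeff-monicOf-< v k k<v

-- Scaling by the reduced leading coefficient c, which is its own inverse, turns a divisor of degree d
-- into a monic one whose lower coefficients are reduced residues.
module MonicRepresentative (q d′ : ℕ) .{{_ : NonZero q}} (units : UnitsSquareToOne q)
                           (f : Poly) (deg : HasDegree q f (suc d′)) where

  c : ℕ
  c = coeff f (suc d′) %ℕ q

  residue : ℕ → ℕ
  residue i = (+ c * coeff f i) %ℕ q

  residue<q : ∀ i → residue i < q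
  residue<q i = n%ℕd<d (+ c * coeff f i) q

  representative : List ℤ
  representative = applyUpTo (λ i → + residue i) (suc d′)

  Fᵣ : Series
  Fᵣ = coeff (monicOf representative)

  length-representative : length representative ≡ suc d′
  length-representative = Listₚ.length-applyUpTo (λ i → + residue i) (suc d′)

  Fᵣ-monic : Monicˢ (suc d′) Fᵣ
  Fᵣ-monic = subst (λ d → Monicˢ d Fᵣ) length-representative (monicOf-monic representative)

  c-∣ : + q ∣ + c - coeff f (suc d′)
  c-∣ = reduce-∣ q (coeff f (suc d′))

  0<c : 0 < c
  0<c with c in c≡
  ... | suc _ = s≤s z≤n
  ... | zero  = ⊥-elim (proj₁ deg (∣⇒∣ᵤ (subst (_ ∣_) (negate (coeff f (suc d′)))
                  (∣m⇒∣-m (subst (λ c → + q ∣ + c - coeff f (suc d′)) c≡ c-∣)))))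
    where
    negate : ∀ a → - (+ 0 - a) ≡ a - + 0
    negate = solve-∀

  f≈c•Fᵣ : coeff f ≈ˢ + c •ˢ Fᵣ [mod q ]
  f≈c•Fᵣ = mk≈ˢ coefficient
    where
    coefficient : ∀ i → + q ∣ coeff f i - + c * Fᵣ i
    coefficient i with ℕₚ.<-cmp i (suc d′)
    ... | tri< i<d _ _ =
      subst (_ ∣_) (trans (expand (coeff f i) (+ c) (+ residue i))
                          (cong (λ x → coeff f i - + c * x) (sym (trans
                            (coeff-monicOf-< representative i (subst (i <_) (sym length-representative) i<d))
                            (coeff-applyUpTo-< (λ i → + residue i) (suc d′) i i<d)))))
        (∣m∣n⇒∣m+n (∣m⇒∣-m (∣n⇒∣m*n (+ c) (reduce-∣ q (+ c * coeff f i))))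
                   (∣m⇒∣-m (∣n⇒∣m*n (coeff f i) (units c 0<c (n%ℕd<d (coeff f (suc d′)) q)))))
      where
      expand : ∀ a c r → - (c * (r - c * a)) + - (a * (c * c - + 1)) ≡ a - c * r
      expand = solve-∀
    ... | tri≈ _ refl _ =
      subst (_ ∣_) (trans (swap (coeff f i) (+ c)) (cong (λ x → coeff f i - + c * x) (sym (proj₁ Fᵣ-monic))))
        (∣m⇒∣-m c-∣)
      where
      swap : ∀ a c → - (c - a) ≡ a - c * + 1
      swap = solve-∀
    ... | tri> _ _ d<i =
      subst (_ ∣_) (cong (λ x → coeff f i - x) (sym (trans (cong (+ c *_) (proj₂ Fᵣ-monic i d<i)) (ℤₚ.*-zeroʳ (+ c)))))
        (∣ᵤ⇒∣ (proj₂ deg i d<i))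

  Fᵣ-divides : ∀ {n} → Divides q f (xⁿ-1 n) → ∃ λ G → Fᵣ *ˢ coeff G ≈ˢ coeff (xⁿ-1 n) [mod q ]
  Fᵣ-divides (g , fg≈) =
    map (+ c *_) g ,
    ≈ˢ-trans (≗⇒≈ˢ scaled)
      (≈ˢ-trans (*ˢ-≈ˢˡ (coeff g) (≈ˢ-sym f≈c•Fᵣ))
        (≈ˢ-trans (≗⇒≈ˢ (λ k → sym (coeff-⊛ f g k))) (mk≈ˢ λ k → ∣ᵤ⇒∣ (fg≈ k))))
    where
    scaled : Fᵣ *ˢ coeff (map (+ c *_) g) ≗ (+ c •ˢ Fᵣ) *ˢ coeff g
    scaled k = trans (*ˢ-congʳ (coeff-map-* (+ c) g) k)
                     (trans (*ˢ-•ˢ-comm (+ c) Fᵣ (coeff g) k) (sym (•ˢ-*ˢ-assoc (+ c) Fᵣ (coeff g) k)))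

coeff-xⁿ-1-zero : ∀ n → 0 < n → coeff (xⁿ-1 n) 0 ≡ -1ℤ
coeff-xⁿ-1-zero (suc n) _ = refl

module _ (q d′ K : ℕ) .{{_ : NonZero q}} .{{_ : NonZero K}} (residues : List ℕ) where

  open PowerRemainder q d′

  -- A monic candidate with lower coefficients v is ruled out as a factor of xⁿ − 1 for all n with
  -- n mod K among the residues: either x divides it, or x^K ≡ 1 but x^r ≢ 1 modulo it for those residues r.
  Excluded : List ℤ → Set
  Excluded v = + q ∣ coeff v 0
             ⊎ xpowRem v K ≡ xpowRem v 0
               × All (λ r → ¬ (∀ {k} → k < suc d′ → + q ∣ coeff (xpowRem v r) k - 1ˢ k)) residues

  excluded? : ∀ v → Dec (Excluded v)
  excluded? v =
    (+ q ∣? coeff v 0)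
      ⊎-dec (Listₚ.≡-dec ℤ._≟_ (xpowRem v K) (xpowRem v 0)
               ×-dec all? (λ r → ¬? (ℕₚ.allUpTo? (λ k → + q ∣? (coeff (xpowRem v r) k - 1ˢ k)) (suc d′))) residues)

  no-factor-of-degree : 1 < q → UnitsSquareToOne q → True (allReduced? q (suc d′) excluded?) →
    ∀ n → 0 < n → n ℕ.% K ∈ residues → ∀ f → HasDegree q f (suc d′) → ¬ Divides q f (xⁿ-1 n)
  no-factor-of-degree 1<q units check n 0<n n%K∈ f deg f∣xⁿ-1
    with Fᵣ-divides {n} f∣xⁿ-1 | AllReduced-applyUpTo (suc d′) {Excluded} (toWitness check) residue residue<q
    where open MonicRepresentative q d′ units f deg
  ... | G , FG≈ | inj₁ q∣v₀ = ℕₚ.<⇒≱ 1<q (ℕ∣.∣⇒≤ (∣⇒∣ᵤ q∣1))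
    where
    open MonicRepresentative q d′ units f deg
    q∣1 : + q ∣ + 1
    q∣1 = subst (_ ∣_) (trans (cong (λ x → (+ residue 0 * coeff G 0 - x) + - (coeff G 0 * + residue 0))
                                    (coeff-xⁿ-1-zero n 0<n))
                              (cancel (+ residue 0) (coeff G 0)))
            (∣m∣n⇒∣m+n (coeff-∣ FG≈ 0) (∣m⇒∣-m (∣n⇒∣m*n (coeff G 0) q∣v₀)))
      where
      cancel : ∀ a g → (a * g - -1ℤ) + - (g * a) ≡ + 1
      cancel = solve-∀
  ... | G , FG≈ | inj₂ (period , not-one) =
    All.lookup not-one n%K∈ λ {k} _ →
      subst (λ s → + q ∣ coeff s k - 1ˢ k) (xpowRem-mod representative K period n)
        (coeff-∣ (xpowRem-≈1 representative length-representative n G FG≈) k)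
    where open MonicRepresentative q d′ units f deg

n<m^n : ∀ m n → 1 < m → n < m ℕ.^ n
n<m^n m zero    1<m = s≤s z≤n
n<m^n m (suc n) 1<m = begin-strict
  suc n                    ≡⟨ ℕₚ.+-identityʳ (suc n) ⟨
  suc n ℕ.+ 0              <⟨ ℕₚ.+-mono-≤-< (n<m^n m n 1<m) (ℕₚ.m^n>0 m n) ⟩
  m ℕ.^ n ℕ.+ m ℕ.^ n       ≡⟨ cong (m ℕ.^ n ℕ.+_) (ℕₚ.+-identityʳ (m ℕ.^ n)) ⟨
  2 ℕ.* m ℕ.^ n            ≤⟨ ℕₚ.*-monoˡ-≤ (m ℕ.^ n) 1<m ⟩
  m ℕ.^ suc n              ∎
  where
  open ℕₚ.≤-Reasoning
  instance _ = ℕ.>-nonZero (ℕₚ.<-trans (s≤s z≤n) 1<m)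

residues-closed : ∀ K .{{_ : NonZero K}} A R → True (all? (λ r → all? (λ a → ((r ℕ.* a) ℕ.% K) ∈? R) A) R) →
  ∀ a → a ℕ.% K ∈ A → ∀ m x → x ℕ.% K ∈ R → (x ℕ.* a ℕ.^ m) ℕ.% K ∈ R
residues-closed K A R closed a a∈A zero    x x∈R = subst (λ y → y ℕ.% K ∈ R) (sym (ℕₚ.*-identityʳ x)) x∈R
residues-closed K A R closed a a∈A (suc m) x x∈R =
  subst (λ y → y ℕ.% K ∈ R) (ℕₚ.*-assoc x a (a ℕ.^ m)) (residues-closed K A R closed a a∈A m (x ℕ.* a) xa∈R)
  where
  xa∈R : (x ℕ.* a) ℕ.% K ∈ R
  xa∈R = subst (_∈ R) (sym (%-distribˡ-* x a K)) (All.lookup (All.lookup (toWitness closed) x∈R) a∈A)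

prime%6∈ : Prime p → p ≢ 2 → p ≢ 3 → p ℕ.% 6 ∈ 1 ∷ 5 ∷ []
prime%6∈ {p} pr p≢2 p≢3 = residue (p ℕ.% 6) refl (m%n<n p 6)
  where
  divisor≡p : ∀ {d} → 1 < d → d ℕ∣.∣ 6 → d ℕ∣.∣ p ℕ.% 6 → d ≡ p
  divisor≡p {d} 1<d d∣6 d∣r with prime⇒irreducible pr
    (subst (d ℕ∣.∣_) (sym (m≡m%n+[m/n]*n p 6)) (ℕ∣.∣m∣n⇒∣m+n d∣r (ℕ∣.∣-trans d∣6 (ℕ∣.n∣m*n (p ℕ./ 6)))))
  ... | inj₁ refl = ⊥-elim (ℕₚ.<-irrefl refl 1<d)
  ... | inj₂ d≡p  = d≡p
  2∣ : ∀ {r} → p ℕ.% 6 ≡ r → 2 ℕ∣.∣ r → ¬ p ℕ.% 6 ≡ r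
  2∣ eq 2∣r _ = p≢2 (sym (divisor≡p (s≤s (s≤s z≤n)) (ℕ∣.divides 3 refl) (subst (2 ℕ∣.∣_) (sym eq) 2∣r)))
  residue : ∀ r → p ℕ.% 6 ≡ r → r < 6 → r ∈ 1 ∷ 5 ∷ []
  residue 0 eq _ = ⊥-elim (2∣ eq (ℕ∣.divides 0 refl) eq)
  residue 1 eq _ = here refl
  residue 2 eq _ = ⊥-elim (2∣ eq (ℕ∣.divides 1 refl) eq)
  residue 3 eq _ = ⊥-elim (p≢3 (sym (divisor≡p (s≤s (s≤s z≤n)) (ℕ∣.divides 2 refl) (subst (3 ℕ∣.∣_) (sym eq) (ℕ∣.divides 1 refl)))))
  residue 4 eq _ = ⊥-elim (2∣ eq (ℕ∣.divides 2 refl) eq)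
  residue 5 eq _ = there (here refl)
  residue (suc (suc (suc (suc (suc (suc _)))))) _ (s≤s (s≤s (s≤s (s≤s (s≤s (s≤s ()))))))

units-mod-2 : UnitsSquareToOne 2
units-mod-2 1 _ _ = ∣0
units-mod-2 (suc (suc _)) _ (s≤s (s≤s ()))

units-mod-3 : UnitsSquareToOne 3
units-mod-3 1 _ _ = ∣0
units-mod-3 2 _ _ = divides (+ 1) refl
units-mod-3 (suc (suc (suc _))) _ (s≤s (s≤s (s≤s ())))

no-factor⇒¬IsPPractical : ∀ {q n} d → 1 ℕ.≤ d → d ℕ.≤ n → (∀ f → HasDegree q f d → ¬ Divides q f (xⁿ-1 n)) → ¬ IsPPractical q n
no-factor⇒¬IsPPractical d 1≤d d≤n no-factor practical =
  let f , deg , f∣ = practical d 1≤d d≤n in no-factor f deg f∣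

prime[3] : Prime 3
prime[3] = toWitness {a? = prime? 3} tt

-- The residues of 3^j (j ≥ 1) modulo 420 and of 14·5^j modulo 312.
3-residues 14·5-residues : List ℕ
3-residues    = 3 ∷ 9 ∷ 27 ∷ 81 ∷ 87 ∷ 141 ∷ 243 ∷ 249 ∷ 261 ∷ 309 ∷ 327 ∷ 363 ∷ []
14·5-residues = 14 ∷ 38 ∷ 70 ∷ 190 ∷ []

no-quadratic-factor-mod-2 : ∀ n → 0 < n → n ℕ.% 6 ∈ 1 ∷ 5 ∷ [] → ∀ f → HasDegree 2 f 2 → ¬ Divides 2 f (xⁿ-1 n)
no-quadratic-factor-mod-2 = no-factor-of-degree 2 1 6 (1 ∷ 5 ∷ []) (s≤s (s≤s z≤n)) units-mod-2 tt

no-quartic-factor-mod-2 : ∀ n → 0 < n → n ℕ.% 420 ∈ 3-residues → ∀ f → HasDegree 2 f 4 → ¬ Divides 2 f (xⁿ-1 n)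
no-quartic-factor-mod-2 = no-factor-of-degree 2 3 420 3-residues (s≤s (s≤s z≤n)) units-mod-2 tt

no-cubic-factor-mod-3 : ∀ n → 0 < n → n ℕ.% 312 ∈ 14·5-residues → ∀ f → HasDegree 3 f 3 → ¬ Divides 3 f (xⁿ-1 n)
no-cubic-factor-mod-3 = no-factor-of-degree 3 2 312 14·5-residues (s≤s (s≤s z≤n)) units-mod-3 tt

14·5^N-not-3-practical : ∀ N → ¬ IsPPractical 3 (14 ℕ.* 5 ℕ.^ N)
14·5^N-not-3-practical N = no-factor⇒¬IsPPractical 3 (s≤s z≤n) 3≤n
  (no-cubic-factor-mod-3 _ (ℕₚ.≤-trans (s≤s z≤n) 3≤n)
    (residues-closed 312 (5 ∷ []) 14·5-residues tt 5 (here refl) N 14 (here refl)))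
  where
  instance _ = ℕₚ.m^n≢0 5 N
  3≤n = ℕₚ.≤-trans (ℕₚ.m≤m+n 3 11) (ℕₚ.m≤m*n 14 (5 ℕ.^ N))

3^[N+2]-not-2-practical : ∀ N → ¬ IsPPractical 2 (3 ℕ.^ suc (suc N))
3^[N+2]-not-2-practical N = subst (λ n → ¬ IsPPractical 2 n) (ℕₚ.*-assoc 3 3 (3 ℕ.^ N))
  (no-factor⇒¬IsPPractical 4 (s≤s z≤n) 4≤n
    (no-quartic-factor-mod-2 _ (ℕₚ.≤-trans (s≤s z≤n) 4≤n)
      (residues-closed 420 (3 ∷ []) 3-residues tt 3 (here refl) N 9 (there (here refl)))))
  where
  instance _ = ℕₚ.m^n≢0 3 N
  4≤n = ℕₚ.≤-trans (ℕₚ.m≤m+n 4 5) (ℕₚ.m≤m*n 9 (3 ℕ.^ N))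

p^[N+1]-not-2-practical : Prime p → p ≢ 2 → p ≢ 3 → ∀ N → ¬ IsPPractical 2 (p ℕ.^ suc N)
p^[N+1]-not-2-practical {p} pr p≢2 p≢3 N = no-factor⇒¬IsPPractical 2 (s≤s z≤n) 2≤n
  (no-quadratic-factor-mod-2 _ (ℕₚ.≤-trans (s≤s z≤n) 2≤n)
    (residues-closed 6 (1 ∷ 5 ∷ []) (1 ∷ 5 ∷ []) tt p p%6∈ N p p%6∈))
  where
  instance _ = prime⇒nonZero pr
  instance _ = ℕₚ.m^n≢0 p N
  p%6∈ = prime%6∈ pr p≢2 p≢3
  2≤n = ℕₚ.≤-trans (ℕ.nonTrivial⇒n>1 p {{prime⇒nonTrivial pr}}) (ℕₚ.m≤m*n p (p ℕ.^ N))

counterexample : ∀ {p N} n → N < n → IsPPractical p n → ¬ IsλPractical n →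
                 ∃ λ n → N < n × 0 < n × IsPPractical p n × ¬ IsλPractical n
counterexample n N<n practical not-λ = n , N<n , ℕₚ.≤-<-trans z≤n N<n , practical , not-λ

proposition6p2 : ∀ (p : ℕ) → Prime p → ∀ (N : ℕ) → ∃ λ (n : ℕ) → N < n × 0 < n × IsPPractical p n × ¬ IsλPractical n
proposition6p2 2 pr N =
  counterexample (14 ℕ.* 5 ℕ.^ N) N<n
    (HasAllFactorDegrees⇒IsPPractical (s≤s (s≤s z≤n)) (14·5^J-ladder N))
    (λ λ-practical → 14·5^N-not-3-practical N (λ-practical 3 prime[3]))
  where
  instance _ = ℕₚ.m^n≢0 5 N
  N<n = ℕₚ.<-≤-trans (n<m^n 5 N (s≤s (s≤s z≤n))) (ℕₚ.m≤n*m (5 ℕ.^ N) 14)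
proposition6p2 3 pr N =
  counterexample (3 ℕ.^ suc (suc N)) (ℕₚ.<-trans (ℕₚ.m<n+m N (s≤s z≤n)) (n<m^n 3 (2 ℕ.+ N) (s≤s (s≤s z≤n))))
    (HasAllFactorDegrees⇒IsPPractical (s≤s (s≤s z≤n)) (primePower-ladder pr (suc (suc N))))
    (λ λ-practical → 3^[N+2]-not-2-practical N (λ-practical 2 prime[2]))
proposition6p2 p@(suc (suc (suc (suc _)))) pr N =
  counterexample (p ℕ.^ suc N) (ℕₚ.<-trans (ℕₚ.n<1+n N) (n<m^n p (suc N) 1<p))
    (HasAllFactorDegrees⇒IsPPractical 1<p (primePower-ladder pr (suc N)))
    (λ λ-practical → p^[N+1]-not-2-practical pr (λ ()) (λ ()) N (λ-practical 2 prime[2]))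
  where
  1<p : 1 < p
  1<p = s≤s (s≤s z≤n)
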